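{- Let $\lambda$ be a partition with at most $n$ parts and $R:=R_\lambda$. Let $\mathcal{A}_R=S_n^{R\text{ - }312}$ and $\mathcal{P}_\lambda=\{Y_\lambda(\pi):\pi\in\mathcal{A}_R\}$; let $\mathcal{B}_R$ be the set of $R$-rightmost clump deleting chains and $\mathcal{Q}_\lambda$ the set of gapless $\lambda$-keys; let $\mathcal{C}_R=UG_R(n)$ and $\mathcal{R}_\lambda=\{M_\lambda(\gamma):\gamma\in\mathcal{C}_R\}$. Then: (i) tableau portrayal $B\mapsto Y_\lambda(B)$ is a bijection from $\mathcal{B}_R$ to $\mathcal{Q}_\lambda$, and $\gamma\mapsto M_\lambda(\gamma)$ is a bijection from $\mathcal{C}_R$ to $\mathcal{R}_\lambda$. (ii) $\mathcal{P}_\lambda=\mathcal{Q}_\lambda$; the map $\pi\mapsto B$ (with $B_h=\{\pi_1,\dots,\pi_{q_h}\}$) restricted to $\mathcal{A}_R$ induces the identity map from $\mathcal{P}_\lambda$ to $\mathcal{Q}_\lambda$; so an $R$-permutation is $R$-312-avoiding if and only if its $\lambda$-key is gapless. (iii) If $\pi\in S_n^R$ is $R$-312-avoiding, then $M_\lambda(\Psi_R(\pi))=Y_\lambda(\pi)$. Consequently $\mathcal{P}_\lambda=\mathcal{R}_\lambda$ and $\Psi_R:\mathcal{A}_R\to\mathcal{C}_R$ induces the identity map from $\mathcal{P}_\lambda$ to $\mathcal{R}_\lambda$.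
   Context: Fix $n\ge1$; $[m]=\{1,\dots,m\}$, $(a,b]=\{a+1,\dots,b\}$; $\mathrm{rank}^d(Q)$ = $d$-th largest element of finite $Q\subset\mathbb{Z}$. Partition $\lambda=(\lambda_1\ge\cdots\ge\lambda_n\ge0)$; boxes $(j,i)$, $1\le j\le\lambda_1$, $1\le i\le\zeta_j=\#\{i:\lambda_i\ge j\}$. $R_\lambda=\{q_1<\cdots<q_r\}\subseteq[n-1]$ = column lengths less than $n$; $q_0=0$, $q_{r+1}=n$, $p_h=q_h-q_{h-1}$, carrels $(q_{h-1},q_h]$. $R$-tuples $\nu\in[n]^n$; $UI_R(n)$: tuples with $\nu_i\ge i$ strictly increasing on each carrel. $S_n^R$: permutations $\pi$ of $[n]$ strictly increasing on each carrel; $R$-312-containing if there exist $h\in[r-1]$, $a\le q_h<b\le q_{h+1}<c\le n$ with $\pi_b<\pi_c<\pi_a$, else $R$-312-avoiding ($S_n^{R\text{ - }312}$). $\Psi_R(\pi)_i=\mathrm{rank}^{q_h-i+1}(\{\pi_1,\dots,\pi_{q_h}\})$ for $i\in(q_{h-1},q_h]$. Gapless $R$-tuple: $\gamma\in UI_R(n)$ such that for each $h\in[r]$ with $\gamma_{q_h}>\gamma_{q_h+1}$, $s=\gamma_{q_h}-\gamma_{q_h+1}+1\le p_{h+1}$ and $\gamma_{q_h+t}=\gamma_{q_h}-s+t$, $t=1,\dots,s$; set $UG_R(n)$. An $R$-chain is $\emptyset=B_0\subset B_1\subset\cdots\subset B_r\subset B_{r+1}=[n]$ with $|B_h|=q_h$.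 A clump of a set of integers is a maximal subset of consecutive integers. The chain is $R$-rightmost clump deleting if for each $h\in[r]$, writing $B_{h+1}=L_1\cup\cdots\cup L_f$ as its clumps in increasing order, there is $e\in[f]$ with $L_e\cup\cdots\cup L_f\supseteq B_{h+1}\setminus B_h\supseteq L_{e+1}\cup\cdots\cup L_f$. Tableaux: $T_j(i)\in[n]$ strictly increasing down columns, weakly along rows; $\mathcal{T}_\lambda$, ordered entrywise; $B(T_j)$ = set of entries of column $j$. For $Q\subseteq[n]$, $Y(Q)$ is the column with entries $Q$ increasing downward. The tableau portrayal $Y_\lambda(B)$ of an $R$-chain has columns left to right: $\lambda_n$ copies of $Y([n])$, then for $h=r,\dots,1$, $\lambda_{q_h}-\lambda_{q_{h+1}}$ copies of $Y(B_h)$; for $\pi\in S_n^R$ the $\lambda$-key $Y_\lambda(\pi)$ is the portrayal of $B_h=\{\pi_1,\dots,\pi_{q_h}\}$. A $\lambda$-key is $Y\in\mathcal{T}_\lambda$ with $B(Y_l)\supseteq B(Y_j)$ for $l\le j$. A $\lambda$-key $Y$ is gapless if for every $h\in[r-1]$: letting $b$ be the smallest value in the columns of length $q_{h+1}$ not appearing in the columns of length $q_h$, and $m$ the largest value in the columns of length $q_h$, if $b<m$ then every integer of $[b,m]$ appears in the columns of length $q_{h+1}$. For $\alpha\in UI_R(n)$, $M_\lambda(\alpha)$ is the entrywise maximum of $\{T\in\mathcal{T}_\lambda:T_{\lambda_i}(i)=\alpha_i\text{ for all }i\text{ with }\lambda_i\ge1\}$ (a nonempty set closed under entrywise max). -}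

module Defs where

open import Data.Nat using (ℕ; zero; suc; _+_; _∸_; _≤_; _<_; _≡ᵇ_; _<ᵇ_; _≤ᵇ_)
open import Data.Bool using (Bool; true; false; _∧_; if_then_else_)
open import Data.Bool.ListAction using (any)
open import Data.List using (List; []; _∷_; _++_; map; length; applyUpTo; reverse; replicate; concat)
open import Data.Product using (Σ; ∃; ∃-syntax; _×_; _,_)
open import Relation.Nullary using (¬_)
open import Relation.Binary.PropositionalEquality using (_≡_)

-- Generic helpers (all indices are 1-based natural numbers, as in the paper)

-- [a , b] = {a, a+1, ..., b}  (empty if b < a)
seg : ℕ → ℕ → List ℕ
seg a b = applyUpTo (a +_) (suc b ∸ a)

filterB : {A : Set} → (A → Bool) → List A → List A
filterB p [] = []
filterB p (x ∷ xs) = if p x then x ∷ filterB p xs else filterB p xs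

-- k-th element (0-based) with a default
nthD : {A : Set} → A → List A → ℕ → A
nthD d [] _ = d
nthD d (x ∷ xs) zero = x
nthD d (x ∷ xs) (suc k) = nthD d xs k

-- finite subsets of [n] are represented by Boolean predicates on ℕ
SubSet : Set
SubSet = ℕ → Bool

fullSet : ℕ → SubSet
fullSet n x = (1 ≤ᵇ x) ∧ (x ≤ᵇ n)

count : ℕ → SubSet → ℕ
count n S = length (filterB S (seg 1 n))

-- rank^d(Q) : d-th largest element of Q ⊆ [n]  (d ≥ 1)
rank : ℕ → ℕ → SubSet → ℕ
rank n d S = nthD 0 (reverse (filterB S (seg 1 n))) (d ∸ 1)

-- Y(Q) : the column with entries Q increasing downward (row i ↦ i-th smallest)
column : ℕ → SubSet → ℕ → ℕ
column n S i = nthD 0 (filterB S (seg 1 n)) (i ∸ 1)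

firstSet : (ℕ → ℕ) → ℕ → SubSet
firstSet π k x = any (λ i → π i ≡ᵇ x) (seg 1 k)

IsLeast : (ℕ → Set) → ℕ → Set
IsLeast P b = P b × (∀ y → P y → b ≤ y)

IsGreatest : (ℕ → Set) → ℕ → Set
IsGreatest P m = P m × (∀ y → P y → y ≤ m)

-- Partitions λ = (λ_1 ≥ ... ≥ λ_n ≥ 0), given as a function on indices 1..n

IsPartition : ℕ → (ℕ → ℕ) → Set
IsPartition n lam = ∀ i → 1 ≤ i → i < n → lam (suc i) ≤ lam i

IsClump : SubSet → ℕ → ℕ → Set
IsClump S a b = a ≤ b × (∀ x → a ≤ x → x ≤ b → S x ≡ true)
              × (∀ y → suc y ≡ a → S y ≡ false) × S (suc b) ≡ false

-- x lies in the union of the clumps L_e ∪ ... ∪ L_f, where L_e starts at a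
InClumpsFrom : SubSet → ℕ → ℕ → Set
InClumpsFrom S a x = ∃[ a' ] ∃[ b' ] (IsClump S a' b' × a ≤ a' × a' ≤ x × x ≤ b')

-- x lies in the union of the clumps L_{e+1} ∪ ... ∪ L_f, where L_e starts at a
InClumpsAfter : SubSet → ℕ → ℕ → Set
InClumpsAfter S a x = ∃[ a' ] ∃[ b' ] (IsClump S a' b' × a < a' × a' ≤ x × x ≤ b')

module _ (n : ℕ) (lam : ℕ → ℕ) where

  -- ζ_j = #{ i ∈ [n] : λ_i ≥ j }  (length of column j)
  zeta : ℕ → ℕ
  zeta j = length (filterB (λ i → j ≤ᵇ lam i) (seg 1 n))

  isR : ℕ → Bool
  isR q = (q <ᵇ n) ∧ any (λ j → zeta j ≡ᵇ q) (seg 1 (lam 1))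

  Rlist : List ℕ
  Rlist = filterB isR (seg 1 (n ∸ 1))

  r : ℕ
  r = length Rlist

  -- q_0 = 0, q_1 < ... < q_r, q_{r+1} = n
  q : ℕ → ℕ
  q h = nthD 0 (0 ∷ Rlist ++ n ∷ []) h

  p : ℕ → ℕ
  p h = q h ∸ q (h ∸ 1)

  -- the h ∈ [r+1] with i ∈ (q_{h-1}, q_h]
  carrel : ℕ → ℕ
  carrel i = suc (length (filterB (λ x → x <ᵇ i) Rlist))

  TupleEq : (ℕ → ℕ) → (ℕ → ℕ) → Set
  TupleEq ν ν' = ∀ i → 1 ≤ i → i ≤ n → ν i ≡ ν' i

  IncOnCarrels : (ℕ → ℕ) → Set
  IncOnCarrels ν = ∀ h → 1 ≤ h → h ≤ suc r →
                   ∀ i → q (h ∸ 1) < i → suc i ≤ q h → ν i < ν (suc i)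

  UI : (ℕ → ℕ) → Set
  UI ν = (∀ i → 1 ≤ i → i ≤ n → i ≤ ν i × ν i ≤ n) × IncOnCarrels ν

  UG : (ℕ → ℕ) → Set
  UG γ = UI γ ×
         (∀ h → 1 ≤ h → h ≤ r → γ (suc (q h)) < γ (q h) →
            let s = γ (q h) ∸ γ (suc (q h)) + 1 in
            s ≤ p (suc h) ×
            (∀ t → 1 ≤ t → t ≤ s → γ (q h + t) ≡ (γ (q h) + t) ∸ s))

  IsPerm : (ℕ → ℕ) → Set
  IsPerm π = (∀ i → 1 ≤ i → i ≤ n → 1 ≤ π i × π i ≤ n)
           × (∀ i j → 1 ≤ i → i ≤ n → 1 ≤ j → j ≤ n → π i ≡ π j → i ≡ j)

  SnR : (ℕ → ℕ) → Set
  SnR π = IsPerm π × IncOnCarrels π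

  Contains312 : (ℕ → ℕ) → Set
  Contains312 π = ∃[ h ] ∃[ a ] ∃[ b ] ∃[ c ]
    ( (1 ≤ h × h ≤ r ∸ 1)
    × (1 ≤ a × a ≤ q h × q h < b × b ≤ q (suc h) × q (suc h) < c × c ≤ n)
    × (π b < π c × π c < π a) )

  Avoids312 : (ℕ → ℕ) → Set
  Avoids312 π = SnR π × ¬ Contains312 π

  Psi : (ℕ → ℕ) → ℕ → ℕ
  Psi π i = rank n (suc (q (carrel i) ∸ i)) (firstSet π (q (carrel i)))

  Chain : Set
  Chain = ℕ → SubSet

  IsRChain : Chain → Set
  IsRChain B = (∀ x → B 0 x ≡ false)
             × (∀ x → B (suc r) x ≡ fullSet n x)
             × (∀ h → h ≤ suc r → ∀ x → B h x ≡ true → 1 ≤ x × x ≤ n)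
             × (∀ h → h ≤ r → ∀ x → B h x ≡ true → B (suc h) x ≡ true)
             × (∀ h → h ≤ suc r → count n (B h) ≡ q h)

  ChainEq : Chain → Chain → Set
  ChainEq B B' = ∀ h → h ≤ suc r → ∀ x → B h x ≡ B' h x

  IsRCD : Chain → Set
  IsRCD B = IsRChain B ×
    (∀ h → 1 ≤ h → h ≤ r → ∃[ a ] ∃[ b ]
       ( IsClump (B (suc h)) a b
       × (∀ x → B (suc h) x ≡ true → B h x ≡ false → InClumpsFrom (B (suc h)) a x)
       × (∀ x → InClumpsAfter (B (suc h)) a x → B (suc h) x ≡ true × B h x ≡ false)))

  chainOf : (ℕ → ℕ) → Chain
  chainOf π h = firstSet π (q h)

  -- Tableaux of shape λ : T j i = entry in column j, row i

  Tab : Set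
  Tab = ℕ → ℕ → ℕ

  Box : ℕ → ℕ → Set
  Box j i = 1 ≤ j × j ≤ lam 1 × 1 ≤ i × i ≤ zeta j

  InT : Tab → Set
  InT T = (∀ j i → Box j i → 1 ≤ T j i × T j i ≤ n)
        × (∀ j i → 1 ≤ j → j ≤ lam 1 → 1 ≤ i → suc i ≤ zeta j → T j i < T j (suc i))
        × (∀ j i → 1 ≤ j → suc j ≤ lam 1 → 1 ≤ i → i ≤ zeta (suc j) → T j i ≤ T (suc j) i)

  TabEq : Tab → Tab → Set
  TabEq T T' = ∀ j i → Box j i → T j i ≡ T' j i

  TabLe : Tab → Tab → Set
  TabLe T T' = ∀ j i → Box j i → T j i ≤ T' j i

  colSet : Tab → ℕ → SubSet
  colSet T j x = any (λ i → T j i ≡ᵇ x) (seg 1 (zeta j))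

  IsKey : Tab → Set
  IsKey Y = InT Y × (∀ l j → 1 ≤ l → l ≤ j → j ≤ lam 1 →
                       ∀ x → colSet Y j x ≡ true → colSet Y l x ≡ true)

  InColsOfLen : Tab → ℕ → ℕ → Set
  InColsOfLen Y len x = ∃[ j ] (1 ≤ j × j ≤ lam 1 × zeta j ≡ len × colSet Y j x ≡ true)

  IsGaplessKey : Tab → Set
  IsGaplessKey Y = IsKey Y ×
    (∀ h → 1 ≤ h → h ≤ r ∸ 1 → ∀ b m →
       IsLeast (λ x → InColsOfLen Y (q (suc h)) x × ¬ InColsOfLen Y (q h) x) b →
       IsGreatest (InColsOfLen Y (q h)) m →
       b < m → ∀ x → b ≤ x → x ≤ m → InColsOfLen Y (q (suc h)) x)

  portrayal : Chain → Tab
  portrayal B j = nthD (λ _ → 0) cols (j ∸ 1)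
    where
    cols : List (ℕ → ℕ)
    cols = replicate (lam n) (column n (fullSet n))
        ++ concat (map (λ h → replicate (lam (q h) ∸ lam (q (suc h))) (column n (B h)))
                       (reverse (seg 1 r)))

  keyOf : (ℕ → ℕ) → Tab
  keyOf π = portrayal (chainOf π)

  -- M_λ(α) : the entrywise maximum of {T ∈ 𝒯_λ : T_{λ_i}(i) = α_i when λ_i ≥ 1}

  Fits : (ℕ → ℕ) → Tab → Set
  Fits α T = ∀ i → 1 ≤ i → i ≤ n → 1 ≤ lam i → T (lam i) i ≡ α i

  IsM : (ℕ → ℕ) → Tab → Set
  IsM α M = (InT M × Fits α M) × (∀ T → InT T → Fits α T → TabLe T M)

module Submission where

-- A λ-key is the portrayal of the R-chain formed by the sets of entries of its columns, and every
-- R-chain B is the chain of exactly one R-permutation (list B h ∖ B (h-1) increasingly on each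
-- carrel). The three gap notions of the theorem are all the same property of the chain: a new
-- element y of B (h+1) lying below some element m of B h forces [y, m] ⊆ B (h+1). For the
-- permutation, a failure is a 312-pattern; for the chain, a failure of rightmost clump deletion;
-- for the key, a gap between its columns of lengths q_h and q_{h+1}.
-- For (iii): entries of a tableau in 𝒯_λ increase strictly down columns and weakly along rows, so
-- if T fits Ψ_R(π), its entry in row i of column j is at most Ψ_R(π)_k − (k − i) for each row k ≥ i
-- of column j. In a gapless chain the key's column runs through consecutive values from row i down
-- to a suitable such k, so the key attains the bound and equals M_λ(Ψ_R(π)); the same runs make
-- Ψ_R(π) gapless.
-- Conversely a gapless tuple γ determines, carrel by carrel, a gapless chain whose permutation π
-- has Ψ_R(π) = γ.

open import Defs
open import Data.Nat
open import Data.Nat.Properties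
open import Data.Bool using (Bool; true; false; _∧_; _∨_; not; T; if_then_else_)
open import Data.Bool.Properties using (∧-identityʳ; ∨-identityʳ)
open import Data.Bool.ListAction using (any)
open import Data.List using (List; []; _∷_; _++_; length; reverse; replicate; concat; map)
open import Data.List.Properties using (length-++; applyUpTo-∷ʳ; reverse-++; length-reverse; unfold-reverse; ++-identityʳ)
open import Data.Product hiding (map)
open import Data.Sum using (_⊎_; inj₁; inj₂)
open import Data.Unit using (tt)
open import Data.Empty using (⊥; ⊥-elim)
open import Relation.Binary.PropositionalEquality
open import Relation.Nullary using (¬_; Dec; yes; no)
open import Relation.Binary using (tri<; tri≈; tri>)

true≢false : true ≢ false
true≢false ()

T⇒≡true : ∀ {b} → T b → b ≡ true
T⇒≡true {true} _ = refl

≡true⇒T : ∀ {b} → b ≡ true → T b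
≡true⇒T refl = tt

≢true⇒≡false : ∀ {b} → b ≢ true → b ≡ false
≢true⇒≡false {true} p = ⊥-elim (p refl)
≢true⇒≡false {false} _ = refl

≤⇒≤ᵇ≡true : ∀ {m n} → m ≤ n → (m ≤ᵇ n) ≡ true
≤⇒≤ᵇ≡true p = T⇒≡true (≤⇒≤ᵇ p)

≤ᵇ≡true⇒≤ : ∀ {m n} → (m ≤ᵇ n) ≡ true → m ≤ n
≤ᵇ≡true⇒≤ {m} {n} e = ≤ᵇ⇒≤ m n (≡true⇒T e)

>⇒≤ᵇ≡false : ∀ {m n} → n < m → (m ≤ᵇ n) ≡ false
>⇒≤ᵇ≡false p = ≢true⇒≡false (λ e → <⇒≱ p (≤ᵇ≡true⇒≤ e))

<⇒<ᵇ≡true : ∀ {m n} → m < n → (m <ᵇ n) ≡ true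
<⇒<ᵇ≡true p = T⇒≡true (<⇒<ᵇ p)

<ᵇ≡true⇒< : ∀ {m n} → (m <ᵇ n) ≡ true → m < n
<ᵇ≡true⇒< {m} {n} e = <ᵇ⇒< m n (≡true⇒T e)

≥⇒<ᵇ≡false : ∀ {m n} → n ≤ m → (m <ᵇ n) ≡ false
≥⇒<ᵇ≡false p = ≢true⇒≡false (λ e → <⇒≱ (<ᵇ≡true⇒< e) p)

≡⇒≡ᵇ≡true : ∀ {m n} → m ≡ n → (m ≡ᵇ n) ≡ true
≡⇒≡ᵇ≡true {m} {n} p = T⇒≡true (≡⇒≡ᵇ m n p)

≡ᵇ≡true⇒≡ : ∀ {m n} → (m ≡ᵇ n) ≡ true → m ≡ n
≡ᵇ≡true⇒≡ {m} {n} e = ≡ᵇ⇒≡ m n (≡true⇒T e)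

≢⇒≡ᵇ≡false : ∀ {m n} → m ≢ n → (m ≡ᵇ n) ≡ false
≢⇒≡ᵇ≡false p = ≢true⇒≡false (λ e → p (≡ᵇ≡true⇒≡ e))

∧≡true⇒ : ∀ {a b} → (a ∧ b) ≡ true → a ≡ true × b ≡ true
∧≡true⇒ {true} {true} _ = refl , refl

∧≡true : ∀ {a b} → a ≡ true → b ≡ true → (a ∧ b) ≡ true
∧≡true refl refl = refl

∧≡falseˡ : ∀ {a} b → a ≡ false → (a ∧ b) ≡ false
∧≡falseˡ b refl = refl

∧≡falseʳ : ∀ a {b} → b ≡ false → (a ∧ b) ≡ false
∧≡falseʳ true refl = refl
∧≡falseʳ false refl = refl

∨≡true⇒ : ∀ {a b} → (a ∨ b) ≡ true → a ≡ true ⊎ b ≡ true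
∨≡true⇒ {true} _ = inj₁ refl
∨≡true⇒ {false} e = inj₂ e

∨≡trueˡ : ∀ {a} b → a ≡ true → (a ∨ b) ≡ true
∨≡trueˡ b refl = refl

∨≡trueʳ : ∀ a {b} → b ≡ true → (a ∨ b) ≡ true
∨≡trueʳ true refl = refl
∨≡trueʳ false refl = refl

∨≡false : ∀ {a b} → a ≡ false → b ≡ false → (a ∨ b) ≡ false
∨≡false refl refl = refl

not≡true : ∀ {b} → b ≡ false → not b ≡ true
not≡true refl = refl

not≡true⇒ : ∀ {b} → not b ≡ true → b ≡ false
not≡true⇒ {false} _ = refl

≡true⇔⇒≡ : ∀ {a b : Bool} → (a ≡ true → b ≡ true) → (b ≡ true → a ≡ true) → a ≡ b
≡true⇔⇒≡ {true} {true} f g = refl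
≡true⇔⇒≡ {true} {false} f g = sym (f refl)
≡true⇔⇒≡ {false} {true} f g = g refl
≡true⇔⇒≡ {false} {false} f g = refl

≤∸1⇒< : ∀ {x y} → x ≤ y ∸ 1 → 1 ≤ y → x < y
≤∸1⇒< {x} {suc y} p _ = s≤s p

<⇒≤∸1 : ∀ {x y} → x < y → x ≤ y ∸ 1
<⇒≤∸1 {x} {suc y} (s≤s p) = p

∸1<⇒ : ∀ i x → i ∸ 1 < x → i ≤ x
∸1<⇒ zero x _ = z≤n
∸1<⇒ (suc i) x a = a

+∸-shift : ∀ m x t → x ≤ m → (m + suc t) ∸ (m ∸ x + 1) ≡ x + t
+∸-shift m x t p = trans (cong (_∸ (m ∸ x + 1)) m+1+t) (m+n∸m≡n (m ∸ x + 1) (x + t))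
  where
  open ≡-Reasoning
  m+1+t : m + suc t ≡ (m ∸ x + 1) + (x + t)
  m+1+t = begin
    m + suc t ≡⟨ cong (_+ suc t) (sym (m∸n+n≡m p)) ⟩
    (m ∸ x + x) + suc t ≡⟨ +-assoc (m ∸ x) x (suc t) ⟩
    (m ∸ x) + (x + suc t) ≡⟨ cong ((m ∸ x) +_) (+-suc x t) ⟩
    (m ∸ x) + suc (x + t) ≡⟨ sym (+-assoc (m ∸ x) 1 (x + t)) ⟩
    (m ∸ x + 1) + (x + t) ∎

-- Counting elements of finite sets

_⊆_ : SubSet → SubSet → Set
S ⊆ S' = ∀ x → S x ≡ true → S' x ≡ true

filterB-++ : ∀ {A : Set} (p : A → Bool) xs ys → filterB p (xs ++ ys) ≡ filterB p xs ++ filterB p ys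
filterB-++ p [] ys = refl
filterB-++ p (x ∷ xs) ys with p x
... | true = cong (x ∷_) (filterB-++ p xs ys)
... | false = filterB-++ p xs ys

filterB-filterB : ∀ {A : Set} (s p : A → Bool) xs → filterB p (filterB s xs) ≡ filterB (λ x → s x ∧ p x) xs
filterB-filterB s p [] = refl
filterB-filterB s p (x ∷ xs) with s x
... | false = filterB-filterB s p xs
... | true with p x
...   | true = cong (x ∷_) (filterB-filterB s p xs)
...   | false = filterB-filterB s p xs

seg-suc : ∀ y → seg 1 (suc y) ≡ seg 1 y ++ (suc y ∷ [])
seg-suc y = sym (applyUpTo-∷ʳ (1 +_) y)

elemsTo : SubSet → ℕ → List ℕ
elemsTo S y = filterB S (seg 1 y)

-- countTo S y = #(S ∩ [1, y]), so that count n S = countTo S n.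
countTo : SubSet → ℕ → ℕ
countTo S y = length (elemsTo S y)

elemsTo-suc : ∀ S y → elemsTo S (suc y) ≡ elemsTo S y ++ filterB S (suc y ∷ [])
elemsTo-suc S y = trans (cong (filterB S) (seg-suc y)) (filterB-++ S (seg 1 y) (suc y ∷ []))

elemsTo-suc-∈ : ∀ S y → S (suc y) ≡ true → elemsTo S (suc y) ≡ elemsTo S y ++ (suc y ∷ [])
elemsTo-suc-∈ S y e rewrite elemsTo-suc S y | e = refl

elemsTo-suc-∉ : ∀ S y → S (suc y) ≡ false → elemsTo S (suc y) ≡ elemsTo S y
elemsTo-suc-∉ S y e rewrite elemsTo-suc S y | e = ++-identityʳ (elemsTo S y)

countTo-suc-∈ : ∀ S y → S (suc y) ≡ true → countTo S (suc y) ≡ suc (countTo S y)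
countTo-suc-∈ S y e rewrite elemsTo-suc-∈ S y e | length-++ (elemsTo S y) {suc y ∷ []} = +-comm (countTo S y) 1

countTo-suc-∉ : ∀ S y → S (suc y) ≡ false → countTo S (suc y) ≡ countTo S y
countTo-suc-∉ S y e = cong length (elemsTo-suc-∉ S y e)

countTo-suc : ∀ S y → (S (suc y) ≡ true × countTo S (suc y) ≡ suc (countTo S y))
                    ⊎ (S (suc y) ≡ false × countTo S (suc y) ≡ countTo S y)
countTo-suc S y with S (suc y) in e
... | true = inj₁ (refl , countTo-suc-∈ S y e)
... | false = inj₂ (refl , countTo-suc-∉ S y e)

countTo-suc-≥ : ∀ S y → countTo S y ≤ countTo S (suc y)
countTo-suc-≥ S y with countTo-suc S y
... | inj₁ (_ , e) = subst (countTo S y ≤_) (sym e) (n≤1+n _)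
... | inj₂ (_ , e) = ≤-reflexive (sym e)

countTo-suc-≤ : ∀ S y → countTo S (suc y) ≤ suc (countTo S y)
countTo-suc-≤ S y with countTo-suc S y
... | inj₁ (_ , e) = ≤-reflexive e
... | inj₂ (_ , e) = subst (_≤ suc (countTo S y)) (sym e) (n≤1+n _)

countTo-mono : ∀ S {y y'} → y ≤ y' → countTo S y ≤ countTo S y'
countTo-mono S {y} {zero} z≤n = ≤-refl
countTo-mono S {y} {suc y'} p with m≤n⇒m<n∨m≡n p
... | inj₂ refl = ≤-refl
... | inj₁ q = ≤-trans (countTo-mono S (s≤s⁻¹ q)) (countTo-suc-≥ S y')

countTo≤ : ∀ S y → countTo S y ≤ y
countTo≤ S zero = z≤n
countTo≤ S (suc y) = ≤-trans (countTo-suc-≤ S y) (s≤s (countTo≤ S y))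

countTo-<⇒< : ∀ S {a b} → countTo S a < countTo S b → a < b
countTo-<⇒< S {a} {b} p with a <? b
... | yes q = q
... | no q = ⊥-elim (<⇒≱ p (countTo-mono S (≮⇒≥ q)))

countTo-⊆ : ∀ S S' → S ⊆ S' → ∀ y → countTo S y ≤ countTo S' y
countTo-⊆ S S' sub zero = z≤n
countTo-⊆ S S' sub (suc y) with countTo-suc S y | countTo-suc S' y
... | inj₁ (_ , e) | inj₁ (_ , e') rewrite e | e' = s≤s (countTo-⊆ S S' sub y)
... | inj₁ (t , e) | inj₂ (f , e') = ⊥-elim (true≢false (trans (sym (sub _ t)) f))
... | inj₂ (_ , e) | inj₁ (_ , e') rewrite e | e' = m≤n⇒m≤1+n (countTo-⊆ S S' sub y)
... | inj₂ (_ , e) | inj₂ (_ , e') rewrite e | e' = countTo-⊆ S S' sub y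

elemsTo-ext : ∀ S S' y → (∀ x → 1 ≤ x → x ≤ y → S x ≡ S' x) → elemsTo S y ≡ elemsTo S' y
elemsTo-ext S S' zero h = refl
elemsTo-ext S S' (suc y) h rewrite elemsTo-suc S y | elemsTo-suc S' y | h (suc y) (s≤s z≤n) ≤-refl
  = cong (_++ filterB S' (suc y ∷ [])) (elemsTo-ext S S' y (λ x p q → h x p (m≤n⇒m≤1+n q)))

countTo-ext : ∀ S S' y → (∀ x → 1 ≤ x → x ≤ y → S x ≡ S' x) → countTo S y ≡ countTo S' y
countTo-ext S S' y h = cong length (elemsTo-ext S S' y h)

countTo-const : ∀ S a y → a ≤ y → (∀ x → a < x → x ≤ y → S x ≡ false) → countTo S y ≡ countTo S a
countTo-const S a zero z≤n h = refl
countTo-const S a (suc y) p h with m≤n⇒m<n∨m≡n p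
... | inj₂ refl = refl
... | inj₁ q = trans (countTo-suc-∉ S y (h (suc y) q ≤-refl))
                     (countTo-const S a y (s≤s⁻¹ q) (λ x r s → h x r (m≤n⇒m≤1+n s)))

countTo-∅ : ∀ S y → (∀ x → S x ≡ false) → countTo S y ≡ 0
countTo-∅ S y none = countTo-const S 0 y z≤n (λ x _ _ → none x)

countTo-∈ : ∀ S x → S x ≡ true → 1 ≤ x → countTo S x ≡ suc (countTo S (x ∸ 1))
countTo-∈ S (suc x) e _ = countTo-suc-∈ S x e

countTo-pos : ∀ S x y → S x ≡ true → 1 ≤ x → x ≤ y → 1 ≤ countTo S y
countTo-pos S x y e p q = ≤-trans (subst (1 ≤_) (sym (countTo-∈ S x e p)) (s≤s z≤n)) (countTo-mono S q)

countTo-attains : ∀ S y i → 1 ≤ i → i ≤ countTo S y →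
                  ∃[ x ] (S x ≡ true × 1 ≤ x × x ≤ y × countTo S x ≡ i)
countTo-attains S zero i p q = ⊥-elim (<⇒≱ p q)
countTo-attains S (suc y) i p q with i ≤? countTo S y
... | yes r = let (x , a , b , c , d) = countTo-attains S y i p r in x , a , b , m≤n⇒m≤1+n c , d
... | no r with countTo-suc S y
...   | inj₁ (t , e) = suc y , t , s≤s z≤n , ≤-refl , ≤-antisym (subst (_≤ i) (sym e) (≰⇒> r)) q
...   | inj₂ (f , e) = ⊥-elim (r (subst (i ≤_) e q))

countTo-∪ : ∀ S S' → (∀ x → S x ≡ true → S' x ≡ false) → ∀ y →
            countTo (λ x → S x ∨ S' x) y ≡ countTo S y + countTo S' y
countTo-∪ S S' dj zero = refl
countTo-∪ S S' dj (suc y) with countTo-suc S y | countTo-suc S' y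
... | inj₁ (t , e) | inj₁ (t' , e') = ⊥-elim (true≢false (trans (sym t') (dj _ t)))
... | inj₁ (t , e) | inj₂ (f' , e') rewrite e | e' =
  trans (countTo-suc-∈ (λ x → S x ∨ S' x) y (∨≡trueˡ _ t)) (cong suc (countTo-∪ S S' dj y))
... | inj₂ (f , e) | inj₁ (t' , e') rewrite e | e' =
  trans (countTo-suc-∈ (λ x → S x ∨ S' x) y (∨≡trueʳ _ t')) (trans (cong suc (countTo-∪ S S' dj y)) (sym (+-suc _ _)))
... | inj₂ (f , e) | inj₂ (f' , e') rewrite e | e' =
  trans (countTo-suc-∉ (λ x → S x ∨ S' x) y (∨≡false f f')) (countTo-∪ S S' dj y)

countTo-complement : ∀ S y → countTo S y + countTo (λ x → not (S x)) y ≡ y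
countTo-complement S zero = refl
countTo-complement S (suc y) with countTo-suc S y
... | inj₁ (t , e) rewrite e | countTo-suc-∉ (λ x → not (S x)) y (cong not t) = cong suc (countTo-complement S y)
... | inj₂ (f , e) rewrite e | countTo-suc-∈ (λ x → not (S x)) y (cong not f) =
  trans (+-suc _ _) (cong suc (countTo-complement S y))

countTo-dropFirst : ∀ S K y → countTo (λ z → S z ∧ (K <ᵇ countTo S z)) y ≡ countTo S y ∸ K
countTo-dropFirst S K zero = sym (0∸n≡0 K)
countTo-dropFirst S K (suc y) with countTo-suc S y
... | inj₂ (f , e) rewrite e = trans (countTo-suc-∉ _ y (∧≡falseˡ _ f)) (countTo-dropFirst S K y)
... | inj₁ (t , e) rewrite e with K <? suc (countTo S y)
...   | yes q = trans (countTo-suc-∈ _ y (∧≡true t (trans (cong (K <ᵇ_) e) (<⇒<ᵇ≡true q))))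
                      (trans (cong suc (countTo-dropFirst S K y)) (sym (+-∸-assoc 1 (s≤s⁻¹ q))))
...   | no q = trans (countTo-suc-∉ _ y (∧≡falseʳ _ (trans (cong (K <ᵇ_) e) (≥⇒<ᵇ≡false (≮⇒≥ q)))))
                     (trans (countTo-dropFirst S K y)
                            (trans (m≤n⇒m∸n≡0 (≤-trans (n≤1+n _) (≮⇒≥ q))) (sym (m≤n⇒m∸n≡0 (≮⇒≥ q)))))

countTo-interval : ∀ S a b → a ≤ b → (∀ z → a < z → z ≤ b → S z ≡ true) → countTo S b ≡ countTo S a + (b ∸ a)
countTo-interval S a zero z≤n h = sym (+-identityʳ _)
countTo-interval S a (suc b) p h with m≤n⇒m<n∨m≡n p
... | inj₂ refl = trans (sym (+-identityʳ _)) (cong (countTo S (suc b) +_) (sym (n∸n≡0 (suc b))))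
... | inj₁ q = trans (countTo-suc-∈ S b (h (suc b) q ≤-refl))
                (trans (cong suc (countTo-interval S a b (s≤s⁻¹ q) (λ z r s → h z r (m≤n⇒m≤1+n s))))
                  (trans (sym (+-suc _ _)) (cong (countTo S a +_) (sym (+-∸-assoc 1 (s≤s⁻¹ q))))))

countTo-⊂ : ∀ S S' → S ⊆ S' → ∀ z y → S' z ≡ true → S z ≡ false → 1 ≤ z → z ≤ y →
            suc (countTo S y) ≤ countTo S' y
countTo-⊂ S S' sub z y t f p q =
  subst (suc (countTo S y) ≤_) (trans (sym (countTo-∪ S D dj y)) (countTo-ext _ _ y (λ x _ _ → S∪D≡S' x)))
        (subst (_≤ countTo S y + countTo D y) (+-comm (countTo S y) 1)
               (+-monoʳ-≤ (countTo S y) (countTo-pos D z y (∧≡true t (not≡true f)) p q)))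
  where
  D : SubSet
  D x = S' x ∧ not (S x)
  dj : ∀ x → S x ≡ true → D x ≡ false
  dj x e = ∧≡falseʳ (S' x) (cong not e)
  S∪D≡S' : ∀ x → (S x ∨ D x) ≡ S' x
  S∪D≡S' x with S x in e1 | S' x in e2
  ... | true | true = refl
  ... | true | false = ⊥-elim (true≢false (trans (sym (sub x e1)) e2))
  ... | false | b = ∧-identityʳ b

countTo-<⇒∃∉ : ∀ S S' → S ⊆ S' → ∀ y → countTo S y < countTo S' y →
               ∃[ z ] (1 ≤ z × z ≤ y × S' z ≡ true × S z ≡ false)
countTo-<⇒∃∉ S S' sub zero ()
countTo-<⇒∃∉ S S' sub (suc y) p with S (suc y) in e | countTo-suc S' y
... | false | inj₁ (t' , e') = suc y , s≤s z≤n , ≤-refl , t' , e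
... | true | inj₁ (t' , e') =
  let (z , a , b , c , d) = countTo-<⇒∃∉ S S' sub y (s≤s⁻¹ (subst₂ _<_ (countTo-suc-∈ S y e) e' p))
  in z , a , m≤n⇒m≤1+n b , c , d
... | true | inj₂ (f' , e') = ⊥-elim (true≢false (trans (sym (sub _ e)) f'))
... | false | inj₂ (f' , e') =
  let (z , a , b , c , d) = countTo-<⇒∃∉ S S' sub y (subst₂ _<_ (countTo-suc-∉ S y e) e' p)
  in z , a , m≤n⇒m≤1+n b , c , d

⊆∧countTo≡⇒≡ : ∀ n S S' → S ⊆ S' → countTo S n ≡ countTo S' n → (∀ x → S' x ≡ true → 1 ≤ x × x ≤ n) →
               ∀ x → S x ≡ S' x
⊆∧countTo≡⇒≡ n S S' sub c bd x = ≡true⇔⇒≡ (sub x) S'⇒S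
  where
  S'⇒S : S' x ≡ true → S x ≡ true
  S'⇒S e with S x in e2
  ... | true = refl
  ... | false = ⊥-elim (1+n≰n (subst (suc (countTo S n) ≤_) (sym c) (countTo-⊂ S S' sub x n e e2 (proj₁ (bd x e)) (proj₂ (bd x e)))))

nthD-++ˡ : ∀ {A : Set} (d : A) xs ys k → k < length xs → nthD d (xs ++ ys) k ≡ nthD d xs k
nthD-++ˡ d (x ∷ xs) ys zero p = refl
nthD-++ˡ d (x ∷ xs) ys (suc k) p = nthD-++ˡ d xs ys k (s≤s⁻¹ p)

nthD-++ʳ : ∀ {A : Set} (d : A) xs ys k → nthD d (xs ++ ys) (length xs + k) ≡ nthD d ys k
nthD-++ʳ d [] ys k = refl
nthD-++ʳ d (x ∷ xs) ys k = nthD-++ʳ d xs ys k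

nthD-length : ∀ {A : Set} (d : A) xs y ys → nthD d (xs ++ y ∷ ys) (length xs) ≡ y
nthD-length d xs y ys = subst (λ k → nthD d (xs ++ y ∷ ys) k ≡ y) (+-identityʳ (length xs)) (nthD-++ʳ d xs (y ∷ ys) 0)

nthD-reverse : ∀ {A : Set} (d : A) xs k → k < length xs → nthD d (reverse xs) k ≡ nthD d xs (length xs ∸ suc k)
nthD-reverse d (x ∷ xs) k p rewrite unfold-reverse x xs with k <? length xs
... | yes q = trans (nthD-++ˡ d (reverse xs) (x ∷ []) k (subst (k <_) (sym (length-reverse xs)) q))
                    (trans (nthD-reverse d xs k q) (cong (nthD d (x ∷ xs)) (sym (+-∸-assoc 1 q))))
... | no q with ≤-antisym (s≤s⁻¹ p) (≮⇒≥ q)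
...   | refl = trans (subst (λ j → nthD d (reverse xs ++ x ∷ []) j ≡ x) (length-reverse xs) (nthD-length d (reverse xs) x []))
                     (cong (nthD d (x ∷ xs)) (sym (n∸n≡0 (length xs))))

nthD-replicate : ∀ {A : Set} (d : A) a c rest k → k < a → nthD d (replicate a c ++ rest) k ≡ c
nthD-replicate d (suc a) c rest zero p = refl
nthD-replicate d (suc a) c rest (suc k) p = nthD-replicate d a c rest k (s≤s⁻¹ p)

nthD-replicate-++ : ∀ {A : Set} (d : A) a c rest k → nthD d (replicate a c ++ rest) (a + k) ≡ nthD d rest k
nthD-replicate-++ d zero c rest k = refl
nthD-replicate-++ d (suc a) c rest k = nthD-replicate-++ d a c rest k

-- Columns

column-countTo : ∀ n S x → S x ≡ true → 1 ≤ x → x ≤ n → column n S (countTo S x) ≡ x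
column-countTo zero S x e p q = ⊥-elim (<⇒≱ p q)
column-countTo (suc n) S x e p q with m≤n⇒m<n∨m≡n q
... | inj₁ r = trans (cong (λ l → nthD 0 l (countTo S x ∸ 1)) (elemsTo-suc S n))
                     (trans (nthD-++ˡ 0 (elemsTo S n) _ (countTo S x ∸ 1) below) (column-countTo n S x e p (s≤s⁻¹ r)))
  where
  below : countTo S x ∸ 1 < countTo S n
  below = <-≤-trans (subst (countTo S x ∸ 1 <_) (m∸n+n≡m (countTo-pos S x x e p ≤-refl)) (m<m+n (countTo S x ∸ 1) (s≤s z≤n)))
                    (countTo-mono S (s≤s⁻¹ r))
... | inj₂ refl rewrite countTo-suc-∈ S n e | elemsTo-suc-∈ S n e = nthD-length 0 (elemsTo S n) (suc n) []

column-spec : ∀ n S i → 1 ≤ i → i ≤ countTo S n →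
              ∃[ x ] (S x ≡ true × 1 ≤ x × x ≤ n × countTo S x ≡ i × column n S i ≡ x)
column-spec n S i p q =
  let (x , a , b , c , d) = countTo-attains S n i p q
  in x , a , b , c , d , subst (λ j → column n S j ≡ x) d (column-countTo n S x a b c)

column-ext : ∀ n S S' → (∀ x → 1 ≤ x → x ≤ n → S x ≡ S' x) → ∀ i → column n S i ≡ column n S' i
column-ext n S S' h i = cong (λ l → nthD 0 l (i ∸ 1)) (elemsTo-ext S S' n h)

rank≡column : ∀ n d S → d < countTo S n → rank n (suc d) S ≡ column n S (countTo S n ∸ d)
rank≡column n d S p = trans (nthD-reverse 0 (elemsTo S n) d p)
  (cong (nthD 0 (elemsTo S n)) (trans (cong (countTo S n ∸_) (+-comm 1 d)) (sym (∸-+-assoc (countTo S n) d 1))))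

column-antitone : ∀ n S S' → S ⊆ S' → ∀ i → 1 ≤ i → i ≤ countTo S n → column n S' i ≤ column n S i
column-antitone n S S' sub i a b with column-spec n S i a b
... | x , ex , x1 , xn , cx , colx with countTo-attains S' x i a (≤-trans (≤-reflexive (sym cx)) (countTo-⊆ S S' sub x))
...   | x' , ex' , x'1 , x'x , cx' =
  subst₂ _≤_ (sym (subst (λ w → column n S' w ≡ x') cx' (column-countTo n S' x' ex' x'1 (≤-trans x'x xn)))) (sym colx) x'x

sameColumn⇒⊆ : ∀ n S S' k → countTo S n ≡ k → countTo S' n ≡ k → (∀ x → S x ≡ true → 1 ≤ x × x ≤ n) →
            (∀ i → 1 ≤ i → i ≤ k → column n S i ≡ column n S' i) → S ⊆ S'
sameColumn⇒⊆ n S S' k cS cS' bd same x e with column-spec n S' (countTo S x) (countTo-pos S x x e (proj₁ (bd x e)) ≤-refl)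
                                                     (subst (countTo S x ≤_) (trans cS (sym cS')) (countTo-mono S (proj₂ (bd x e))))
... | y , ey , _ , _ , _ , coly =
  subst (λ w → S' w ≡ true) (trans (sym coly) (trans (sym (same (countTo S x) (countTo-pos S x x e (proj₁ (bd x e)) ≤-refl)
                                                               (subst (countTo S x ≤_) cS (countTo-mono S (proj₂ (bd x e))))))
                                                     (column-countTo n S x e (proj₁ (bd x e)) (proj₂ (bd x e))))) ey

fullSet-∈ : ∀ n x → 1 ≤ x → x ≤ n → fullSet n x ≡ true
fullSet-∈ n x a b = ∧≡true (≤⇒≤ᵇ≡true a) (≤⇒≤ᵇ≡true b)

fullSet-∈⁻ : ∀ n x → fullSet n x ≡ true → 1 ≤ x × x ≤ n
fullSet-∈⁻ n x e = let (a , b) = ∧≡true⇒ {1 ≤ᵇ x} e in ≤ᵇ≡true⇒≤ a , ≤ᵇ≡true⇒≤ b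

countTo-fullSet : ∀ n → countTo (fullSet n) n ≡ n
countTo-fullSet n = countTo-interval (fullSet n) 0 n z≤n (λ z a b → fullSet-∈ n z a b)

any-++ : ∀ {A : Set} (f : A → Bool) xs ys → any f (xs ++ ys) ≡ (any f xs ∨ any f ys)
any-++ f [] ys = refl
any-++ f (x ∷ xs) ys rewrite any-++ f xs ys with f x
... | true = refl
... | false = refl

any-seg⁻ : ∀ (f : ℕ → Bool) b → any f (seg 1 b) ≡ true → ∃[ j ] (1 ≤ j × j ≤ b × f j ≡ true)
any-seg⁻ f zero ()
any-seg⁻ f (suc b) e with ∨≡true⇒ {any f (seg 1 b)} (trans (sym (any-++ f (seg 1 b) (suc b ∷ []))) (trans (cong (any f) (sym (seg-suc b))) e))
... | inj₁ e1 = let (j , x , y , z) = any-seg⁻ f b e1 in j , x , m≤n⇒m≤1+n y , z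
... | inj₂ e2 = suc b , s≤s z≤n , ≤-refl , trans (sym (∨-identityʳ (f (suc b)))) e2

any-seg⁺ : ∀ (f : ℕ → Bool) b j → 1 ≤ j → j ≤ b → f j ≡ true → any f (seg 1 b) ≡ true
any-seg⁺ f zero j p q e = ⊥-elim (<⇒≱ p q)
any-seg⁺ f (suc b) j p q e = trans (cong (any f) (seg-suc b)) (trans (any-++ f (seg 1 b) (suc b ∷ [])) last)
  where
  last : (any f (seg 1 b) ∨ any f (suc b ∷ [])) ≡ true
  last with m≤n⇒m<n∨m≡n q
  ... | inj₁ r = ∨≡trueˡ _ (any-seg⁺ f b j p (s≤s⁻¹ r) e)
  ... | inj₂ refl rewrite e = ∨≡trueʳ (any f (seg 1 b)) refl

any-seg-false : ∀ (f : ℕ → Bool) b → (∀ j → 1 ≤ j → j ≤ b → f j ≡ false) → any f (seg 1 b) ≡ false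
any-seg-false f b h = ≢true⇒≡false (λ e → let (j , x , y , z) = any-seg⁻ f b e in true≢false (trans (sym z) (h j x y)))

firstSet-suc : ∀ (v : ℕ → ℕ) k x → firstSet v (suc k) x ≡ (firstSet v k x ∨ (v (suc k) ≡ᵇ x))
firstSet-suc v k x = trans (cong (any (λ i → v i ≡ᵇ x)) (seg-suc k))
  (trans (any-++ _ (seg 1 k) (suc k ∷ [])) (cong (firstSet v k x ∨_) (∨-identityʳ (v (suc k) ≡ᵇ x))))

firstSet-∈⁻ : ∀ (v : ℕ → ℕ) k x → firstSet v k x ≡ true → ∃[ i ] (1 ≤ i × i ≤ k × v i ≡ x)
firstSet-∈⁻ v k x e = let (i , a , b , c) = any-seg⁻ (λ i → v i ≡ᵇ x) k e in i , a , b , ≡ᵇ≡true⇒≡ c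

firstSet-∈ : ∀ (v : ℕ → ℕ) k i → 1 ≤ i → i ≤ k → firstSet v k (v i) ≡ true
firstSet-∈ v k i a b = any-seg⁺ (λ j → v j ≡ᵇ v i) k i a b (≡⇒≡ᵇ≡true {v i} refl)

firstSet-∉ : ∀ (v : ℕ → ℕ) k x → (∀ i → 1 ≤ i → i ≤ k → v i ≢ x) → firstSet v k x ≡ false
firstSet-∉ v k x h = any-seg-false (λ i → v i ≡ᵇ x) k (λ j a b → ≢⇒≡ᵇ≡false (h j a b))

firstSet-mono : ∀ (v : ℕ → ℕ) k k' → k ≤ k' → firstSet v k ⊆ firstSet v k'
firstSet-mono v k k' p x e with firstSet-∈⁻ v k x e
... | i , a , b , refl = firstSet-∈ v k' i a (≤-trans b p)

firstSet-ext : ∀ (v v' : ℕ → ℕ) k → (∀ i → 1 ≤ i → i ≤ k → v i ≡ v' i) → ∀ x → firstSet v k x ≡ firstSet v' k x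
firstSet-ext v v' k h x = ≡true⇔⇒≡ (transport v v' (λ i a b → h i a b)) (transport v' v (λ i a b → sym (h i a b)))
  where
  transport : ∀ u u' → (∀ i → 1 ≤ i → i ≤ k → u i ≡ u' i) → firstSet u k x ≡ true → firstSet u' k x ≡ true
  transport u u' eq e with firstSet-∈⁻ u k x e
  ... | i , a , b , refl = subst (λ w → firstSet u' k w ≡ true) (sym (eq i a b)) (firstSet-∈ u' k i a b)

singleton : ℕ → SubSet
singleton y x = y ≡ᵇ x

countTo-singleton-< : ∀ y N → N < y → countTo (singleton y) N ≡ 0
countTo-singleton-< y N p = countTo-const (singleton y) 0 N z≤n (λ x a b → ≢⇒≡ᵇ≡false (λ e → <⇒≱ p (subst (_≤ N) (sym e) b)))

countTo-singleton-≥ : ∀ y N → 1 ≤ y → y ≤ N → countTo (singleton y) N ≡ 1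
countTo-singleton-≥ y N a b =
  trans (countTo-const (singleton y) y N b (λ x c d → ≢⇒≡ᵇ≡false (λ e → <-irrefl e c)))
        (trans (countTo-∈ (singleton y) y (≡⇒≡ᵇ≡true {y} refl) a) (cong suc (countTo-singleton-< y (y ∸ 1) (∸1< a))))
  where
  ∸1< : ∀ {y} → 1 ≤ y → y ∸ 1 < y
  ∸1< {suc y} _ = ≤-refl

disjoint-singleton : ∀ S y → S y ≡ false → ∀ x → S x ≡ true → singleton y x ≡ false
disjoint-singleton S y f x e = ≢⇒≡ᵇ≡false (λ yx → true≢false (trans (sym e) (trans (cong S (sym yx)) f)))

countTo-insert-≤ : ∀ S y N → S y ≡ false → 1 ≤ y → y ≤ N → countTo (λ x → S x ∨ singleton y x) N ≡ suc (countTo S N)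
countTo-insert-≤ S y N f a b = trans (countTo-∪ S (singleton y) (disjoint-singleton S y f) N)
  (trans (cong (countTo S N +_) (countTo-singleton-≥ y N a b)) (+-comm (countTo S N) 1))

countTo-insert-> : ∀ S y N → S y ≡ false → N < y → countTo (λ x → S x ∨ singleton y x) N ≡ countTo S N
countTo-insert-> S y N f p = trans (countTo-∪ S (singleton y) (disjoint-singleton S y f) N)
  (trans (cong (countTo S N +_) (countTo-singleton-< y N p)) (+-identityʳ _))

countTo-firstSet : ∀ n (v : ℕ → ℕ) k → (∀ i → 1 ≤ i → i ≤ k → 1 ≤ v i × v i ≤ n) →
                   (∀ i j → 1 ≤ i → i ≤ k → 1 ≤ j → j ≤ k → v i ≡ v j → i ≡ j) → countTo (firstSet v k) n ≡ k
countTo-firstSet n v zero bd inj = countTo-∅ _ n (λ x → refl)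
countTo-firstSet n v (suc k) bd inj =
  trans (countTo-ext _ _ n (λ x _ _ → firstSet-suc v k x))
    (trans (countTo-insert-≤ (firstSet v k) (v (suc k)) n new (proj₁ (bd (suc k) (s≤s z≤n) ≤-refl)) (proj₂ (bd (suc k) (s≤s z≤n) ≤-refl)))
      (cong suc (countTo-firstSet n v k (λ i a b → bd i a (m≤n⇒m≤1+n b))
                                       (λ i j a b c d → inj i j a (m≤n⇒m≤1+n b) c (m≤n⇒m≤1+n d)))))
  where
  new : firstSet v k (v (suc k)) ≡ false
  new = firstSet-∉ v k (v (suc k)) (λ i a b e → <-irrefl (inj i (suc k) a (m≤n⇒m≤1+n b) (s≤s z≤n) ≤-refl e) (s≤s b))

StrictOn : (ℕ → ℕ) → ℕ → Set
StrictOn v k = ∀ i → 1 ≤ i → suc i ≤ k → v i < v (suc i)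

StrictOn-< : ∀ v k → StrictOn v k → ∀ i j → 1 ≤ i → i < j → j ≤ k → v i < v j
StrictOn-< v k st i (suc j) a b c with m≤n⇒m<n∨m≡n b
... | inj₂ refl = st i a c
... | inj₁ t = <-trans (StrictOn-< v k st i j a (s≤s⁻¹ t) (≤-trans (n≤1+n j) c)) (st j (≤-trans a (<⇒≤ (s≤s⁻¹ t))) c)

StrictOn-injective : ∀ v k → StrictOn v k → ∀ i j → 1 ≤ i → i ≤ k → 1 ≤ j → j ≤ k → v i ≡ v j → i ≡ j
StrictOn-injective v k st i j a b c d e with <-cmp i j
... | tri≈ _ x _ = x
... | tri< x _ _ = ⊥-elim (<-irrefl e (StrictOn-< v k st i j a x d))
... | tri> _ _ x = ⊥-elim (<-irrefl (sym e) (StrictOn-< v k st j i c x b))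

StrictOn-suc⁻ : ∀ v k → StrictOn v (suc k) → StrictOn v k
StrictOn-suc⁻ v k st i a b = st i a (m≤n⇒m≤1+n b)

countTo-firstSet-strict : ∀ v k → StrictOn v k → (∀ i → 1 ≤ i → i ≤ k → 1 ≤ v i) → ∀ i → 1 ≤ i → i ≤ k →
                          countTo (firstSet v k) (v i) ≡ i
countTo-firstSet-below : ∀ v k → StrictOn v (suc k) → (∀ i → 1 ≤ i → i ≤ suc k → 1 ≤ v i) →
                         countTo (firstSet v k) (v (suc k)) ≡ k

countTo-firstSet-below v zero st pos = countTo-∅ _ (v 1) (λ x → refl)
countTo-firstSet-below v (suc k) st pos =
  trans (countTo-const _ (v (suc k)) (v (suc (suc k))) (<⇒≤ (st (suc k) (s≤s z≤n) ≤-refl))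
                       (λ x c d → firstSet-∉ v (suc k) x (λ j e f g → <⇒≱ c (subst (_≤ v (suc k)) g (v≤last j e f)))))
        (countTo-firstSet-strict v (suc k) (StrictOn-suc⁻ v (suc k) st) (λ j c d → pos j c (m≤n⇒m≤1+n d)) (suc k) (s≤s z≤n) ≤-refl)
  where
  v≤last : ∀ j → 1 ≤ j → j ≤ suc k → v j ≤ v (suc k)
  v≤last j e f with m≤n⇒m<n∨m≡n f
  ... | inj₂ refl = ≤-refl
  ... | inj₁ t = <⇒≤ (StrictOn-< v (suc (suc k)) st j (suc k) e t (n≤1+n _))

countTo-firstSet-strict v zero st pos i a b = ⊥-elim (<⇒≱ a b)
countTo-firstSet-strict v (suc k) st pos i a b with m≤n⇒m<n∨m≡n b
... | inj₁ t = trans (countTo-ext _ _ (v i) (λ x _ _ → firstSet-suc v k x))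
                 (trans (countTo-insert-> (firstSet v k) (v (suc k)) (v i) new (StrictOn-< v (suc k) st i (suc k) a t ≤-refl))
                   (countTo-firstSet-strict v k (StrictOn-suc⁻ v k st) (λ j c d → pos j c (m≤n⇒m≤1+n d)) i a (s≤s⁻¹ t)))
  where
  new : firstSet v k (v (suc k)) ≡ false
  new = firstSet-∉ v k (v (suc k)) (λ j c d e → <-irrefl e (StrictOn-< v (suc k) st j (suc k) c (s≤s d) ≤-refl))
... | inj₂ refl = trans (countTo-ext _ _ (v (suc k)) (λ x _ _ → firstSet-suc v k x))
                 (trans (countTo-insert-≤ (firstSet v k) (v (suc k)) (v (suc k)) new (pos (suc k) (s≤s z≤n) ≤-refl) ≤-refl)
                   (cong suc (countTo-firstSet-below v k st pos)))
  where
  new : firstSet v k (v (suc k)) ≡ false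
  new = firstSet-∉ v k (v (suc k)) (λ j c d e → <-irrefl e (StrictOn-< v (suc k) st j (suc k) c (s≤s d) ≤-refl))

column-firstSet-strict : ∀ n v k → StrictOn v k → (∀ i → 1 ≤ i → i ≤ k → 1 ≤ v i × v i ≤ n) →
                         ∀ i → 1 ≤ i → i ≤ k → column n (firstSet v k) i ≡ v i
column-firstSet-strict n v k st bd i a b =
  subst (λ j → column n (firstSet v k) j ≡ v i) (countTo-firstSet-strict v k st (λ j c d → proj₁ (bd j c d)) i a b)
        (column-countTo n _ (v i) (firstSet-∈ v k i a b) (proj₁ (bd i a b)) (proj₂ (bd i a b)))

firstSet-column : ∀ n S → (∀ x → S x ≡ true → 1 ≤ x × x ≤ n) → ∀ x → firstSet (column n S) (countTo S n) x ≡ S x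
firstSet-column n S bd x = ≡true⇔⇒≡ ⇒S S⇒
  where
  ⇒S : firstSet (column n S) (countTo S n) x ≡ true → S x ≡ true
  ⇒S e with firstSet-∈⁻ (column n S) (countTo S n) x e
  ... | i , a , b , refl = let (y , ey , _ , _ , _ , cy) = column-spec n S i a b in subst (λ w → S w ≡ true) (sym cy) ey
  S⇒ : S x ≡ true → firstSet (column n S) (countTo S n) x ≡ true
  S⇒ e = subst (λ w → firstSet (column n S) (countTo S n) w ≡ true) (column-countTo n S x e (proj₁ (bd x e)) (proj₂ (bd x e)))
           (firstSet-∈ (column n S) (countTo S n) (countTo S x) (countTo-pos S x x e (proj₁ (bd x e)) ≤-refl) (countTo-mono S (proj₂ (bd x e))))

least : ∀ (P : ℕ → Bool) y → P y ≡ true → ∃[ m ] (P m ≡ true × m ≤ y × (∀ z → z < m → P z ≡ false))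
least P zero e = 0 , e , z≤n , λ z ()
least P (suc y) e with P 0 in e0
... | true = 0 , e0 , z≤n , λ z ()
... | false = let (m , a , b , c) = least (λ x → P (suc x)) y e in
  suc m , a , s≤s b , λ { zero _ → e0 ; (suc z) p → c z (s≤s⁻¹ p) }

greatest : ∀ (P : ℕ → Bool) y → (∃[ m ] (P m ≡ true × m ≤ y × (∀ z → m < z → z ≤ y → P z ≡ false)))
                              ⊎ (∀ z → z ≤ y → P z ≡ false)
greatest P zero with P 0 in e
... | true = inj₁ (0 , e , z≤n , λ z p q → ⊥-elim (<⇒≱ p q))
... | false = inj₂ (λ { zero _ → e })
greatest P (suc y) with P (suc y) in e
... | true = inj₁ (suc y , e , ≤-refl , λ z p q → ⊥-elim (<⇒≱ p q))
... | false with greatest P y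
...   | inj₁ (m , a , b , c) = inj₁ (m , a , m≤n⇒m≤1+n b , λ z p q → upTo-suc z q (c z p))
  where
  upTo-suc : ∀ z → z ≤ suc y → (z ≤ y → P z ≡ false) → P z ≡ false
  upTo-suc z q below with m≤n⇒m<n∨m≡n q
  ... | inj₁ t = below (s≤s⁻¹ t)
  ... | inj₂ refl = e
...   | inj₂ none = inj₂ upTo-suc
  where
  upTo-suc : ∀ z → z ≤ suc y → P z ≡ false
  upTo-suc z q with m≤n⇒m<n∨m≡n q
  ... | inj₁ t = none z (s≤s⁻¹ t)
  ... | inj₂ refl = e

-- Clumps

clump-start : ∀ (S : SubSet) x → S x ≡ true →
              ∃[ a ] (a ≤ x × (∀ z → a ≤ z → z ≤ x → S z ≡ true) × (∀ y → suc y ≡ a → S y ≡ false))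
clump-start S zero e = 0 , z≤n , (λ { zero _ _ → e }) , (λ y ())
clump-start S (suc x) e with S x in e2
... | true = let (a , p , q , r) = clump-start S x e2 in a , m≤n⇒m≤1+n p , extend a q , r
  where
  extend : ∀ a → (∀ z → a ≤ z → z ≤ x → S z ≡ true) → ∀ z → a ≤ z → z ≤ suc x → S z ≡ true
  extend a q z s t with m≤n⇒m<n∨m≡n t
  ... | inj₁ u = q z s (s≤s⁻¹ u)
  ... | inj₂ refl = e
... | false = suc x , ≤-refl , (λ z s t → subst (λ w → S w ≡ true) (≤-antisym s t) e) , λ { y refl → e2 }

clump-end : ∀ N (S : SubSet) → (∀ x → S x ≡ true → x ≤ N) → ∀ d x → x + d ≡ N → S x ≡ true →
            ∃[ b ] (x ≤ b × (∀ z → x ≤ z → z ≤ b → S z ≡ true) × S (suc b) ≡ false)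
clump-end N S bd d x p e with S (suc x) in e2
... | false = x , ≤-refl , (λ z s t → subst (λ w → S w ≡ true) (≤-antisym s t) e) , e2
... | true with d
...   | zero = ⊥-elim (1+n≰n (subst (suc x ≤_) (trans (sym p) (+-identityʳ x)) (bd (suc x) e2)))
...   | suc d' = let (b , s1 , s2 , s3) = clump-end N S bd d' (suc x) (trans (sym (+-suc x d')) p) e2 in
                 b , ≤-trans (n≤1+n x) s1 , extend b s2 , s3
  where
  extend : ∀ b → (∀ z → suc x ≤ z → z ≤ b → S z ≡ true) → ∀ z → x ≤ z → z ≤ b → S z ≡ true
  extend b s2 z u v with m≤n⇒m<n∨m≡n u
  ... | inj₁ t = s2 z t v
  ... | inj₂ refl = e

clump-of : ∀ N (S : SubSet) → (∀ x → S x ≡ true → x ≤ N) → ∀ x → S x ≡ true → ∃[ a ] ∃[ b ] (IsClump S a b × a ≤ x × x ≤ b)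
clump-of N S bd x e with clump-start S x e | clump-end N S bd (N ∸ x) x (m+[n∸m]≡n (bd x e)) e
... | (a , p1 , p2 , p3) | (b , q1 , q2 , q3) = a , b , (≤-trans p1 q1 , inside , p3 , q3) , p1 , q1
  where
  inside : ∀ z → a ≤ z → z ≤ b → S z ≡ true
  inside z u v with z ≤? x
  ... | yes t = p2 z u t
  ... | no t = q2 z (<⇒≤ (≰⇒> t)) v

clump-order : ∀ S a b a' b' → IsClump S a b → IsClump S a' b' → a < a' → b < a'
clump-order S a b (suc a'') b' (_ , c2 , _ , _) (_ , _ , d3 , _) p with b <? suc a''
... | yes t = t
... | no t = ⊥-elim (true≢false (trans (sym (c2 a'' (s≤s⁻¹ p) (≤-trans (n≤1+n a'') (≮⇒≥ t)))) (d3 a'' refl)))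

clump-∈ : ∀ S a b → IsClump S a b → ∀ x → a ≤ x → x ≤ b → S x ≡ true
clump-∈ S a b c = proj₁ (proj₂ c)

clump-after-∉ : ∀ S a b → IsClump S a b → S (suc b) ≡ false
clump-after-∉ S a b c = proj₂ (proj₂ (proj₂ c))

module Shape (n : ℕ) (lam : ℕ → ℕ) (n≥1 : 1 ≤ n) (part : IsPartition n lam) where

  ζ : ℕ → ℕ
  ζ = zeta n lam

  inR : ℕ → Bool
  inR = isR n lam

  Q : ℕ → ℕ
  Q = q n lam

  r′ : ℕ
  r′ = r n lam

  carrel′ : ℕ → ℕ
  carrel′ = carrel n lam

  lam-antitone : ∀ i i' → 1 ≤ i → i ≤ i' → i' ≤ n → lam i' ≤ lam i
  lam-antitone i i' p q s with m≤n⇒m<n∨m≡n q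
  ... | inj₂ refl = ≤-refl
  ... | inj₁ t with i'
  ...   | suc i'' = ≤-trans (part i'' (≤-trans p (s≤s⁻¹ t)) s) (lam-antitone i i'' p (s≤s⁻¹ t) (≤-trans (n≤1+n _) s))

  longRows : ℕ → SubSet
  longRows j i = j ≤ᵇ lam i

  ζ≤n : ∀ j → ζ j ≤ n
  ζ≤n j = countTo≤ (longRows j) n

  ≤lam⇒≤ζ : ∀ j i → 1 ≤ i → i ≤ n → j ≤ lam i → i ≤ ζ j
  ≤lam⇒≤ζ j i p q s = ≤-trans (≤-reflexive (sym (countTo-interval (longRows j) 0 i z≤n (λ z a b → ≤⇒≤ᵇ≡true (≤-trans s (lam-antitone z i a b q))))))
                     (countTo-mono (longRows j) q)

  lam<⇒ζ< : ∀ j i → 1 ≤ i → i ≤ n → lam i < j → ζ j < i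
  lam<⇒ζ< j (suc i) p q s = s≤s (≤-trans (≤-reflexive (countTo-const (longRows j) i n (≤-trans (n≤1+n _) q)
                             (λ x a b → >⇒≤ᵇ≡false (<-≤-trans (≤-trans (s≤s (lam-antitone (suc i) x p a b)) s) ≤-refl))))
                           (countTo≤ (longRows j) i))

  ≤ζ⇒≤lam : ∀ j i → 1 ≤ i → i ≤ n → i ≤ ζ j → j ≤ lam i
  ≤ζ⇒≤lam j i p q s with j ≤? lam i
  ... | yes t = t
  ... | no t = ⊥-elim (<⇒≱ (lam<⇒ζ< j i p q (≰⇒> t)) s)

  ζ-pos : ∀ j → j ≤ lam 1 → 1 ≤ ζ j
  ζ-pos j p = ≤lam⇒≤ζ j 1 ≤-refl n≥1 p

  ζ-antitone : ∀ j j' → j ≤ j' → ζ j' ≤ ζ j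
  ζ-antitone j j' p = countTo-⊆ (longRows j') (longRows j) (λ x e → ≤⇒≤ᵇ≡true (≤-trans p (≤ᵇ≡true⇒≤ e))) n

  Q≡column : ∀ h → 1 ≤ h → h ≤ r′ → Q h ≡ column (n ∸ 1) inR h
  Q≡column (suc h) p s = nthD-++ˡ 0 (Rlist n lam) (n ∷ []) h s

  Q-top : Q (suc r′) ≡ n
  Q-top = nthD-length 0 (Rlist n lam) n []

  Q-spec : ∀ h → 1 ≤ h → h ≤ r′ → inR (Q h) ≡ true × 1 ≤ Q h × Q h ≤ n ∸ 1 × countTo inR (Q h) ≡ h
  Q-spec h p s with column-spec (n ∸ 1) inR h p s
  ... | x , a , b , c , d , e rewrite Q≡column h p s | e = a , b , c , d

  inR⇒<n : ∀ x → inR x ≡ true → x < n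
  inR⇒<n x e = <ᵇ≡true⇒< (proj₁ (∧≡true⇒ e))

  inR⇒column : ∀ x → inR x ≡ true → Σ ℕ λ j → 1 ≤ j × j ≤ lam 1 × ζ j ≡ x
  inR⇒column x e = let (j , a , b , c) = any-seg⁻ (λ j → ζ j ≡ᵇ x) (lam 1) (proj₂ (∧≡true⇒ {x <ᵇ n} e)) in j , a , b , ≡ᵇ≡true⇒≡ c

  column⇒inR : ∀ x j → x < n → 1 ≤ j → j ≤ lam 1 → ζ j ≡ x → inR x ≡ true
  column⇒inR x j p a b c = ∧≡true (<⇒<ᵇ≡true p) (any-seg⁺ (λ j → ζ j ≡ᵇ x) (lam 1) j a b (≡⇒≡ᵇ≡true c))

  Q≤n : ∀ h → h ≤ suc r′ → Q h ≤ n
  Q≤n zero p = z≤n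
  Q≤n (suc h) p with m≤n⇒m<n∨m≡n p
  ... | inj₂ refl = ≤-reflexive Q-top
  ... | inj₁ t = <⇒≤ (≤∸1⇒< (proj₁ (proj₂ (proj₂ (Q-spec (suc h) (s≤s z≤n) (s≤s⁻¹ t))))) n≥1)

  Q-< : ∀ h → h ≤ r′ → Q h < Q (suc h)
  Q-< zero p with m≤n⇒m<n∨m≡n p
  ... | inj₁ t = proj₁ (proj₂ (Q-spec 1 ≤-refl t))
  ... | inj₂ e = subst (λ z → 0 < Q (suc z)) (sym e) (subst (0 <_) (sym Q-top) n≥1)
  Q-< (suc h) p with m≤n⇒m<n∨m≡n p
  ... | inj₂ e = subst (λ z → Q (suc h) < Q (suc z)) (sym e) (subst (Q (suc h) <_) (sym Q-top) (≤∸1⇒< (proj₁ (proj₂ (proj₂ (Q-spec (suc h) (s≤s z≤n) p)))) n≥1))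
  ... | inj₁ t = countTo-<⇒< inR (subst₂ _<_ (sym (proj₂ (proj₂ (proj₂ (Q-spec (suc h) (s≤s z≤n) p)))))
                                           (sym (proj₂ (proj₂ (proj₂ (Q-spec (suc (suc h)) (s≤s z≤n) t))))) ≤-refl)

  Q-mono : ∀ h h' → h ≤ h' → h' ≤ suc r′ → Q h ≤ Q h'
  Q-mono h h' p s with m≤n⇒m<n∨m≡n p
  ... | inj₂ refl = ≤-refl
  ... | inj₁ t with h'
  ...   | suc h'' = ≤-trans (Q-mono h h'' (s≤s⁻¹ t) (≤-trans (n≤1+n _) s)) (<⇒≤ (Q-< h'' (s≤s⁻¹ s)))

  Q-mono-< : ∀ h h' → h < h' → h' ≤ suc r′ → Q h < Q h'
  Q-mono-< h (suc h') p s = <-≤-trans (Q-< h (≤-trans (s≤s⁻¹ p) (s≤s⁻¹ s))) (Q-mono (suc h) (suc h') p s)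

  Q-pos⁻ : ∀ h {i} → 1 ≤ i → i ≤ Q h → 1 ≤ h
  Q-pos⁻ zero a b = ⊥-elim (<⇒≱ a b)
  Q-pos⁻ (suc h) _ _ = s≤s z≤n

  Q-pos : ∀ h → 1 ≤ h → h ≤ suc r′ → 1 ≤ Q h
  Q-pos h p s = ≤-trans (Q-< 0 z≤n) (Q-mono 1 h p s)

  carrel′≡ : ∀ i → 1 ≤ i → i ≤ n → carrel′ i ≡ suc (countTo inR (i ∸ 1))
  carrel′≡ i p s = cong suc (trans (cong length (filterB-filterB inR (λ x → x <ᵇ i) (seg 1 (n ∸ 1))))
                 (trans (countTo-const _ (i ∸ 1) (n ∸ 1) (∸-monoˡ-≤ 1 s) (λ x a b → ∧≡falseʳ (inR x) (≥⇒<ᵇ≡false (∸1<⇒ i x a))))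
                   (countTo-ext _ _ (i ∸ 1) (λ x a b → below x (≤∸1⇒< b p)))))
    where
    below : ∀ x → x < i → (inR x ∧ (x <ᵇ i)) ≡ inR x
    below x t rewrite <⇒<ᵇ≡true t = ∧-identityʳ (inR x)

  carrel′-spec : ∀ i → 1 ≤ i → i ≤ n → 1 ≤ carrel′ i × carrel′ i ≤ suc r′ × Q (carrel′ i ∸ 1) < i × i ≤ Q (carrel′ i)
  carrel′-spec i p s = subst (λ c → 1 ≤ c × c ≤ suc r′ × Q (c ∸ 1) < i × i ≤ Q c) (sym (carrel′≡ i p s)) (s≤s z≤n , s≤s kle , lo , hi)
    where
    k = countTo inR (i ∸ 1)
    kle : k ≤ r′
    kle = countTo-mono inR (∸-monoˡ-≤ 1 s)
    lo : Q k < i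
    lo with k in ek
    ... | zero = p
    ... | suc k' with countTo-attains inR (i ∸ 1) (suc k') (s≤s z≤n) (≤-reflexive (sym ek))
    ...   | x , a , b , c , d = subst (_< i) (sym (trans (Q≡column (suc k') (s≤s z≤n) (subst (_≤ r′) ek kle))
                                  (subst (λ j → column (n ∸ 1) inR j ≡ x) d (column-countTo (n ∸ 1) inR x a b (≤-trans c (∸-monoˡ-≤ 1 s))))))
                                  (≤∸1⇒< c p)
    hi : i ≤ Q (suc k)
    hi with m≤n⇒m<n∨m≡n kle
    ... | inj₂ e = subst (i ≤_) (sym (trans (cong (λ z → Q (suc z)) e) Q-top)) s
    ... | inj₁ t = let (_ , _ , _ , c) = Q-spec (suc k) (s≤s z≤n) t in
                   ∸1<⇒ i _ (countTo-<⇒< inR (subst (k <_) (sym c) ≤-refl))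

  carrel′-unique : ∀ h i → 1 ≤ h → h ≤ suc r′ → Q (h ∸ 1) < i → i ≤ Q h → carrel′ i ≡ h
  carrel′-unique h i a b c d with carrel′-spec i (≤-trans (s≤s z≤n) c) (≤-trans d (Q≤n h b))
  ... | (a' , b' , c' , d') with <-cmp (carrel′ i) h
  ...   | tri≈ _ e _ = e
  ...   | tri< t _ _ = ⊥-elim (<⇒≱ c (≤-trans d' (Q-mono (carrel′ i) (h ∸ 1) (<⇒≤∸1 t) (≤-trans (∸-monoˡ-≤ 1 b) (n≤1+n r′)))))
  ...   | tri> _ _ t = ⊥-elim (<⇒≱ c' (≤-trans d (Q-mono h (carrel′ i ∸ 1) (<⇒≤∸1 t) (≤-trans (∸-monoˡ-≤ 1 b') (n≤1+n r′)))))

  Q-carrel′-least : ∀ i x → 1 ≤ i → i ≤ n → i ≤ x → (inR x ≡ true ⊎ x ≡ n) → Q (carrel′ i) ≤ x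
  Q-carrel′-least i x p s t (inj₂ refl) = Q≤n (carrel′ i) (proj₁ (proj₂ (carrel′-spec i p s)))
  Q-carrel′-least i x p s t (inj₁ e) with x <? Q (carrel′ i)
  ... | no u = ≮⇒≥ u
  ... | yes u = ⊥-elim (<⇒≱ c<cx' (≤-trans cx≤ (≤-reflexive (proj₂ (proj₂ (proj₂ qs))))))
    where
    k = countTo inR (i ∸ 1)
    c≡ : carrel′ i ≡ suc k
    c≡ = carrel′≡ i p s
    x≥1 : 1 ≤ x
    x≥1 = ≤-trans p t
    cx≥ : carrel′ i ≤ countTo inR x
    cx≥ = subst (_≤ countTo inR x) (sym c≡) (subst (suc k ≤_) (sym (countTo-∈ inR x e x≥1)) (s≤s (countTo-mono inR (∸-monoˡ-≤ 1 t))))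
    cle : carrel′ i ≤ r′
    cle = ≤-trans cx≥ (countTo-mono inR (<⇒≤∸1 (inR⇒<n x e)))
    qs = Q-spec (carrel′ i) (proj₁ (carrel′-spec i p s)) cle
    cx≤ : suc (countTo inR x) ≤ countTo inR (Q (carrel′ i))
    cx≤ = subst (suc (countTo inR x) ≤_) (sym (countTo-∈ inR (Q (carrel′ i)) (proj₁ qs) (proj₁ (proj₂ qs)))) (s≤s (countTo-mono inR (<⇒≤∸1 u)))
    c<cx' : carrel′ i < suc (countTo inR x)
    c<cx' = s≤s cx≥

  ζ∈R⊎≡n : ∀ j → 1 ≤ j → j ≤ lam 1 → inR (ζ j) ≡ true ⊎ ζ j ≡ n
  ζ∈R⊎≡n j a b with m≤n⇒m<n∨m≡n (ζ≤n j)
  ... | inj₁ t = inj₁ (column⇒inR (ζ j) j t a b refl)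
  ... | inj₂ e = inj₂ e

  Q-carrel′-ζ : ∀ j → 1 ≤ j → j ≤ lam 1 → Q (carrel′ (ζ j)) ≡ ζ j
  Q-carrel′-ζ j a b = ≤-antisym (Q-carrel′-least (ζ j) (ζ j) (ζ-pos j b) (ζ≤n j) ≤-refl (ζ∈R⊎≡n j a b))
                        (proj₂ (proj₂ (proj₂ (carrel′-spec (ζ j) (ζ-pos j b) (ζ≤n j)))))

  ζ-lam≡Q-carrel′ : ∀ i → 1 ≤ i → i ≤ n → 1 ≤ lam i → ζ (lam i) ≡ Q (carrel′ i)
  ζ-lam≡Q-carrel′ i p s l with <-cmp (Q (carrel′ i)) (ζ (lam i))
  ... | tri≈ _ e _ = sym e
  ... | tri> _ _ u = ⊥-elim (<⇒≱ u (Q-carrel′-least i (ζ (lam i)) p s (≤lam⇒≤ζ (lam i) i p s ≤-refl) (ζ∈R⊎≡n (lam i) l (lam-antitone 1 i ≤-refl p s))))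
  ... | tri< u _ _ = ⊥-elim (<⇒≱ (<-≤-trans lamy1 (≤-trans jle (lam-antitone i y p iy yn))) lamy1≥)
    where
    cs = carrel′-spec i p s
    y = Q (carrel′ i)
    cle : carrel′ i ≤ r′
    cle with m≤n⇒m<n∨m≡n (proj₁ (proj₂ cs))
    ... | inj₁ t = s≤s⁻¹ t
    ... | inj₂ e = ⊥-elim (<⇒≱ u (subst (λ z → ζ (lam i) ≤ Q z) (sym e) (subst (ζ (lam i) ≤_) (sym Q-top) (ζ≤n (lam i)))))
    qs = Q-spec (carrel′ i) (proj₁ cs) cle
    jc = inR⇒column y (proj₁ qs)
    j = proj₁ jc
    iy : i ≤ y
    iy = proj₂ (proj₂ (proj₂ cs))
    yn : y ≤ n
    yn = <⇒≤ (inR⇒<n y (proj₁ qs))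
    y1n : suc y ≤ n
    y1n = ≤-trans u (ζ≤n (lam i))
    lamy1≥ : lam i ≤ lam (suc y)
    lamy1≥ = ≤ζ⇒≤lam (lam i) (suc y) (s≤s z≤n) y1n u
    lamy1 : lam (suc y) < j
    lamy1 with lam (suc y) <? j
    ... | yes t = t
    ... | no t = ⊥-elim (<⇒≱ (subst (_< suc y) (sym (proj₂ (proj₂ (proj₂ jc)))) ≤-refl) (≤lam⇒≤ζ j (suc y) (s≤s z≤n) y1n (≮⇒≥ t)))
    jle : j ≤ lam y
    jle = ≤ζ⇒≤lam j y (≤-trans p iy) yn (≤-reflexive (sym (proj₂ (proj₂ (proj₂ jc)))))

  colsOf : (ℕ → SubSet) → List (ℕ → ℕ)
  colsOf B = replicate (lam n) (column n (fullSet n))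
          ++ concat (map (λ h → replicate (lam (Q h) ∸ lam (Q (suc h))) (column n (B h))) (reverse (seg 1 r′)))

  reverse-seg-suc : ∀ m → reverse (seg 1 (suc m)) ≡ suc m ∷ reverse (seg 1 m)
  reverse-seg-suc m = trans (cong reverse (seg-suc m)) (reverse-++ (seg 1 m) (suc m ∷ []))

  block : (ℕ → SubSet) → ℕ → List (ℕ → ℕ)
  block B h = replicate (lam (Q h) ∸ lam (Q (suc h))) (column n (B h))

  blocks : (ℕ → SubSet) → ℕ → List (ℕ → ℕ)
  blocks B m = concat (map (block B) (reverse (seg 1 m)))

  blocks-suc : ∀ B m → blocks B (suc m) ≡ block B (suc m) ++ blocks B m
  blocks-suc B m = cong (λ l → concat (map (block B) l)) (reverse-seg-suc m)

  lam-Q-antitone : ∀ h h' → 1 ≤ h → h ≤ h' → h' ≤ suc r′ → lam (Q h') ≤ lam (Q h)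
  lam-Q-antitone h h' a b c = lam-antitone (Q h) (Q h') (Q-pos h a (≤-trans b c)) (Q-mono h h' b c) (Q≤n h' c)

  nthD-blocks : ∀ B (d : ℕ → ℕ) m → m ≤ r′ → ∀ h k → 1 ≤ h → h ≤ m → lam (Q (suc h)) ≤ k + lam (Q (suc m)) →
           k + lam (Q (suc m)) < lam (Q h) → nthD d (blocks B m) k ≡ column n (B h)
  nthD-blocks B d zero mr h k a b = ⊥-elim (<⇒≱ a b)
  nthD-blocks B d (suc m) mr h k a b c e with m≤n⇒m<n∨m≡n b
  ... | inj₂ refl = trans (cong (λ l → nthD d l k) (blocks-suc B m)) (nthD-replicate d _ _ _ k klt)
    where
    L12 : lam (Q (suc (suc m))) ≤ lam (Q (suc m))
    L12 = lam-Q-antitone (suc m) (suc (suc m)) (s≤s z≤n) (n≤1+n _) (s≤s mr)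
    klt : k < lam (Q (suc m)) ∸ lam (Q (suc (suc m)))
    klt = +-cancelʳ-< _ k _ (subst (k + lam (Q (suc (suc m))) <_) (sym (m∸n+n≡m L12)) e)
  ... | inj₁ t = trans (cong (λ l → nthD d l k) (blocks-suc B m))
                   (trans (cong (nthD d (block B (suc m) ++ blocks B m)) (sym keq))
                     (trans (nthD-replicate-++ d aa _ _ k')
                            (nthD-blocks B d m (≤-trans (n≤1+n m) mr) h k' a (s≤s⁻¹ t)
                                         (subst (lam (Q (suc h)) ≤_) eq' c) (subst (_< lam (Q h)) eq' e))))
    where
    L1 = lam (Q (suc m))
    L2 = lam (Q (suc (suc m)))
    aa = L1 ∸ L2
    L12 : L2 ≤ L1
    L12 = lam-Q-antitone (suc m) (suc (suc m)) (s≤s z≤n) (n≤1+n _) (s≤s mr)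
    aL : aa + L2 ≡ L1
    aL = m∸n+n≡m L12
    L1≤ : L1 ≤ lam (Q (suc h))
    L1≤ = lam-Q-antitone (suc h) (suc m) (s≤s z≤n) t (≤-trans mr (n≤1+n _))
    ak : aa ≤ k
    ak = +-cancelʳ-≤ L2 aa k (subst (_≤ k + L2) (sym aL) (≤-trans L1≤ c))
    k' = k ∸ aa
    keq : aa + k' ≡ k
    keq = m+[n∸m]≡n ak
    eq' : k + L2 ≡ k' + L1
    eq' = begin
      k + L2 ≡⟨ cong (_+ L2) (sym keq) ⟩
      aa + k' + L2 ≡⟨ cong (_+ L2) (+-comm aa k') ⟩
      k' + aa + L2 ≡⟨ +-assoc k' aa L2 ⟩
      k' + (aa + L2) ≡⟨ cong (k' +_) aL ⟩
      k' + L1 ∎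
      where open ≡-Reasoning

  lam-Q-top : lam (Q (suc r′)) ≡ lam n
  lam-Q-top = cong lam Q-top

  portrayal-full : ∀ B j → 1 ≤ j → j ≤ lam n → portrayal n lam B j ≡ column n (fullSet n)
  portrayal-full B j a b = nthD-replicate (λ _ → 0) (lam n) _ _ (j ∸ 1) (≤∸1⇒< (∸-monoˡ-≤ 1 b) (≤-trans a b))

  portrayal-middle : ∀ B j h → 1 ≤ j → j ≤ lam 1 → 1 ≤ h → h ≤ r′ → ζ j ≡ Q h → portrayal n lam B j ≡ column n (B h)
  portrayal-middle B j h a b c d e =
    trans (cong (nthD (λ _ → 0) (colsOf B)) (sym jeq))
      (trans (nthD-replicate-++ (λ _ → 0) (lam n) _ _ k)
        (nthD-blocks B (λ _ → 0) r′ ≤-refl h k c d (subst (λ z → lam (Q (suc h)) ≤ k + z) (sym lam-Q-top) lo) (subst (λ z → k + z < lam (Q h)) (sym lam-Q-top) hi)))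
    where
    h1 : suc h ≤ suc r′
    h1 = s≤s d
    jle : j ≤ lam (Q h)
    jle = ≤ζ⇒≤lam j (Q h) (Q-pos h c (≤-trans d (n≤1+n r′))) (Q≤n h (≤-trans d (n≤1+n r′))) (≤-reflexive (sym e))
    jgt : lam (Q (suc h)) < j
    jgt with lam (Q (suc h)) <? j
    ... | yes t = t
    ... | no t = ⊥-elim (<⇒≱ (Q-< h d) (subst (Q (suc h) ≤_) e (≤lam⇒≤ζ j (Q (suc h)) (Q-pos (suc h) (s≤s z≤n) h1) (Q≤n (suc h) h1) (≮⇒≥ t))))
    ln : lam n ≤ lam (Q (suc h))
    ln = lam-antitone (Q (suc h)) n (Q-pos (suc h) (s≤s z≤n) h1) (Q≤n (suc h) h1) ≤-refl
    lnj : lam n ≤ j ∸ 1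
    lnj = <⇒≤∸1 (≤-<-trans ln jgt)
    k = j ∸ 1 ∸ lam n
    jeq : lam n + k ≡ j ∸ 1
    jeq = m+[n∸m]≡n lnj
    lo : lam (Q (suc h)) ≤ k + lam n
    lo = subst (lam (Q (suc h)) ≤_) (trans (sym jeq) (+-comm (lam n) k)) (<⇒≤∸1 jgt)
    hi : k + lam n < lam (Q h)
    hi = subst (_< lam (Q h)) (trans (sym jeq) (+-comm (lam n) k)) (≤∸1⇒< (∸-monoˡ-≤ 1 jle) (≤-trans a jle))

module Chains (n : ℕ) (lam : ℕ → ℕ) (n≥1 : 1 ≤ n) (part : IsPartition n lam) where

  open Shape n lam n≥1 part

  module RChain (B : ℕ → SubSet) (ch : IsRChain n lam B) where
    B₀-empty : ∀ x → B 0 x ≡ false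
    B₀-empty = proj₁ ch
    B-top : ∀ x → B (suc r′) x ≡ fullSet n x
    B-top = proj₁ (proj₂ ch)
    B-bounded : ∀ h → h ≤ suc r′ → ∀ x → B h x ≡ true → 1 ≤ x × x ≤ n
    B-bounded = proj₁ (proj₂ (proj₂ ch))
    B-nested : ∀ h → h ≤ r′ → B h ⊆ B (suc h)
    B-nested = proj₁ (proj₂ (proj₂ (proj₂ ch)))
    B-count : ∀ h → h ≤ suc r′ → countTo (B h) n ≡ Q h
    B-count = proj₂ (proj₂ (proj₂ (proj₂ ch)))

    B-mono : ∀ g h → g ≤ h → h ≤ suc r′ → B g ⊆ B h
    B-mono g h p s x e with m≤n⇒m<n∨m≡n p
    ... | inj₂ refl = e
    ... | inj₁ t with h
    ...   | suc h' = B-nested h' (s≤s⁻¹ s) x (B-mono g h' (s≤s⁻¹ t) (≤-trans (n≤1+n _) s) x e)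

    B-top-∈ : ∀ x → 1 ≤ x → x ≤ n → B (suc r′) x ≡ true
    B-top-∈ x a b = trans (B-top x) (fullSet-∈ n x a b)

    Δ : ℕ → SubSet
    Δ h x = B h x ∧ not (B (h ∸ 1) x)

    Δ-∈⁻ : ∀ h x → Δ h x ≡ true → B h x ≡ true × B (h ∸ 1) x ≡ false
    Δ-∈⁻ h x e = let (a , b) = ∧≡true⇒ {B h x} e in a , not≡true⇒ b

    Δ-count : ∀ h → 1 ≤ h → h ≤ suc r′ → Q (h ∸ 1) + countTo (Δ h) n ≡ Q h
    Δ-count (suc h) a b = trans (cong (_+ countTo (Δ (suc h)) n) (sym (B-count h (≤-trans (n≤1+n h) b))))
                         (trans (sym (countTo-∪ (B h) (Δ (suc h)) (λ x e → ∧≡falseʳ (B (suc h) x) (cong not e)) n))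
                           (trans (countTo-ext _ _ n (λ x _ _ → lem x)) (B-count (suc h) b)))
      where
      lem : ∀ x → (B h x ∨ Δ (suc h) x) ≡ B (suc h) x
      lem x with B h x in e1 | B (suc h) x in e2
      ... | true | true = refl
      ... | true | false = ⊥-elim (true≢false (trans (sym (B-nested h (s≤s⁻¹ b) x e1)) e2))
      ... | false | true = refl
      ... | false | false = refl

    πOf : ℕ → ℕ
    πOf i = column n (Δ (carrel′ i)) (i ∸ Q (carrel′ i ∸ 1))

    πOf-spec : ∀ h i → 1 ≤ h → h ≤ suc r′ → Q (h ∸ 1) < i → i ≤ Q h →
              carrel′ i ≡ h × Δ h (πOf i) ≡ true × 1 ≤ πOf i × πOf i ≤ n × countTo (Δ h) (πOf i) ≡ i ∸ Q (h ∸ 1)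
    πOf-spec h i a b c d = ce , xs , xa , xb , xc
      where
      ce = carrel′-unique h i a b c d
      k = i ∸ Q (h ∸ 1)
      k1 : 1 ≤ k
      k1 = m<n⇒0<n∸m c
      kle : k ≤ countTo (Δ h) n
      kle = subst (k ≤_) (trans (cong (_∸ Q (h ∸ 1)) (sym (Δ-count h a b))) (m+n∸m≡n (Q (h ∸ 1)) _)) (∸-monoˡ-≤ (Q (h ∸ 1)) d)
      cs = column-spec n (Δ h) k k1 kle
      x = proj₁ cs
      eqx : πOf i ≡ x
      eqx = trans (cong (λ c → column n (Δ c) (i ∸ Q (c ∸ 1))) ce) (proj₂ (proj₂ (proj₂ (proj₂ (proj₂ cs)))))
      xs : Δ h (πOf i) ≡ true
      xs = subst (λ z → Δ h z ≡ true) (sym eqx) (proj₁ (proj₂ cs))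
      xa : 1 ≤ πOf i
      xa = subst (1 ≤_) (sym eqx) (proj₁ (proj₂ (proj₂ cs)))
      xb : πOf i ≤ n
      xb = subst (_≤ n) (sym eqx) (proj₁ (proj₂ (proj₂ (proj₂ cs))))
      xc : countTo (Δ h) (πOf i) ≡ k
      xc = subst (λ z → countTo (Δ h) z ≡ k) (sym eqx) (proj₁ (proj₂ (proj₂ (proj₂ (proj₂ cs)))))

    πOf-spec′ : ∀ i → 1 ≤ i → i ≤ n → Δ (carrel′ i) (πOf i) ≡ true × 1 ≤ πOf i × πOf i ≤ n × countTo (Δ (carrel′ i)) (πOf i) ≡ i ∸ Q (carrel′ i ∸ 1)
    πOf-spec′ i a b = let (c1 , c2 , c3 , c4) = carrel′-spec i a b in proj₂ (πOf-spec (carrel′ i) i c1 c2 c3 c4)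

    πOf-∈ : ∀ i → 1 ≤ i → i ≤ n → B (carrel′ i) (πOf i) ≡ true
    πOf-∈ i a b = proj₁ (Δ-∈⁻ (carrel′ i) (πOf i) (proj₁ (πOf-spec′ i a b)))

    πOf-increasing : IncOnCarrels n lam πOf
    πOf-increasing h a b i c d with πOf-spec h i a b c (≤-trans (n≤1+n i) d) | πOf-spec h (suc i) a b (<-trans c (n<1+n i)) d
    ... | (_ , _ , _ , _ , k1) | (_ , _ , _ , _ , k2) = countTo-<⇒< (Δ h) (subst₂ _<_ (sym k1) (sym k2) (subst (i ∸ Q (h ∸ 1) <_) (sym (+-∸-assoc 1 (<⇒≤ c))) ≤-refl))

    Δ-disjoint : ∀ g h x → 1 ≤ g → g < h → h ≤ suc r′ → Δ g x ≡ true → Δ h x ≡ false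
    Δ-disjoint g h x a p s e with Δ h x in e2
    ... | false = refl
    ... | true = ⊥-elim (true≢false (trans (sym (B-mono g (h ∸ 1) (<⇒≤∸1 p) (≤-trans (∸-monoˡ-≤ 1 s) (n≤1+n r′)) x (proj₁ (Δ-∈⁻ g x e))))
                                          (proj₂ (Δ-∈⁻ h x e2))))

    πOf-injective : ∀ i j → 1 ≤ i → i ≤ n → 1 ≤ j → j ≤ n → πOf i ≡ πOf j → i ≡ j
    πOf-injective i j a b c d e with carrel′-spec i a b | carrel′-spec j c d | πOf-spec′ i a b | πOf-spec′ j c d
    ... | (ci1 , ci2 , ci3 , ci4) | (cj1 , cj2 , cj3 , cj4) | (di , _ , _ , ki) | (dj , _ , _ , kj) with <-cmp (carrel′ i) (carrel′ j)
    ...   | tri< t _ _ = ⊥-elim (true≢false (trans (sym dj) (subst (λ z → Δ (carrel′ j) z ≡ false) e (Δ-disjoint (carrel′ i) (carrel′ j) (πOf i) ci1 t cj2 di))))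
    ...   | tri> _ _ t = ⊥-elim (true≢false (trans (sym di) (subst (λ z → Δ (carrel′ i) z ≡ false) (sym e) (Δ-disjoint (carrel′ j) (carrel′ i) (πOf j) cj1 t ci2 dj))))
    ...   | tri≈ _ ceq _ = ∸-cancelʳ-≡ (<⇒≤ ci3) (subst (λ z → Q (z ∸ 1) ≤ j) (sym ceq) (<⇒≤ cj3))
                            (trans (sym ki) (trans (cong (countTo (Δ (carrel′ i))) e)
                              (trans (cong (λ z → countTo (Δ z) (πOf j)) ceq) (trans kj (cong (λ z → j ∸ Q (z ∸ 1)) (sym ceq))))))

    ∈Δ : ∀ h → h ≤ suc r′ → ∀ x → B h x ≡ true → Σ ℕ λ g → 1 ≤ g × g ≤ h × Δ g x ≡ true
    ∈Δ zero p x e = ⊥-elim (true≢false (trans (sym e) (B₀-empty x)))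
    ∈Δ (suc h) p x e with B h x in e2
    ... | true = let (g , a , b , c) = ∈Δ h (≤-trans (n≤1+n h) p) x e2 in g , a , m≤n⇒m≤1+n b , c
    ... | false = suc h , s≤s z≤n , ≤-refl , ∧≡true e (not≡true e2)

    chainOf-πOf : ∀ h → h ≤ suc r′ → ∀ x → firstSet πOf (Q h) x ≡ B h x
    chainOf-πOf h hs x = ≡true⇔⇒≡ fwd bwd
      where
      fwd : firstSet πOf (Q h) x ≡ true → B h x ≡ true
      fwd e with firstSet-∈⁻ πOf (Q h) x e
      ... | i , a , b , refl = B-mono (carrel′ i) h cih hs (πOf i) (πOf-∈ i a (≤-trans b (Q≤n h hs)))
        where
        cs = carrel′-spec i a (≤-trans b (Q≤n h hs))
        cih : carrel′ i ≤ h
        cih with carrel′ i ≤? h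
        ... | yes t = t
        ... | no t = ⊥-elim (<⇒≱ (proj₁ (proj₂ (proj₂ cs))) (≤-trans b (Q-mono h (carrel′ i ∸ 1) (<⇒≤∸1 (≰⇒> t)) (≤-trans (∸-monoˡ-≤ 1 (proj₁ (proj₂ cs))) (n≤1+n r′)))))
      bwd : B h x ≡ true → firstSet πOf (Q h) x ≡ true
      bwd e with ∈Δ h hs x e
      ... | g , a , b , dg = subst (λ z → firstSet πOf (Q h) z ≡ true) πx (firstSet-∈ πOf (Q h) i i1 (≤-trans ile (Q-mono g h b hs)))
        where
        gs : g ≤ suc r′
        gs = ≤-trans b hs
        xb = B-bounded g gs x (proj₁ (Δ-∈⁻ g x dg))
        k = countTo (Δ g) x
        k1 : 1 ≤ k
        k1 = countTo-pos (Δ g) x x dg (proj₁ xb) ≤-refl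
        kle : k ≤ countTo (Δ g) n
        kle = countTo-mono (Δ g) (proj₂ xb)
        i = Q (g ∸ 1) + k
        i1 : 1 ≤ i
        i1 = ≤-trans k1 (m≤n+m k _)
        ilo : Q (g ∸ 1) < i
        ilo = subst (_≤ i) (+-comm (Q (g ∸ 1)) 1) (+-monoʳ-≤ (Q (g ∸ 1)) k1)
        ile : i ≤ Q g
        ile = subst (i ≤_) (Δ-count g a gs) (+-monoʳ-≤ (Q (g ∸ 1)) kle)
        πx : πOf i ≡ x
        πx with carrel′-unique g i a gs ilo ile
        ... | ce = trans (cong (λ c → column n (Δ c) (i ∸ Q (c ∸ 1))) ce)
                     (trans (cong (column n (Δ g)) (m+n∸m≡n (Q (g ∸ 1)) k)) (column-countTo n (Δ g) x dg (proj₁ xb) (proj₂ xb)))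

    πOf-IsPerm : IsPerm n lam πOf
    πOf-IsPerm = (λ i a b → let s = πOf-spec′ i a b in proj₁ (proj₂ s) , proj₁ (proj₂ (proj₂ s))) , πOf-injective

    πOf-SnR : SnR n lam πOf
    πOf-SnR = πOf-IsPerm , πOf-increasing

  -- The common content of all the gap conditions: a new element y of B (h+1) below some x ∈ B h
  -- forces [y, x] ⊆ B (h+1).
  ChainGap : (ℕ → SubSet) → Set
  ChainGap B = ∀ h → 1 ≤ h → h ≤ r′ ∸ 1 → ∀ x y z → B h x ≡ true → B (suc h) y ≡ true → B h y ≡ false →
               y ≤ z → z ≤ x → B (suc h) z ≡ true

  RCDCondition : (ℕ → SubSet) → Set
  RCDCondition B = ∀ h → 1 ≤ h → h ≤ r′ → ∃[ a ] ∃[ b ]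
         ( IsClump (B (suc h)) a b
         × (∀ x → B (suc h) x ≡ true → B h x ≡ false → InClumpsFrom (B (suc h)) a x)
         × (∀ x → InClumpsAfter (B (suc h)) a x → B (suc h) x ≡ true × B h x ≡ false))

  h≤r-1 : ∀ h → h ≤ r′ → h ≢ r′ → h ≤ r′ ∸ 1
  h≤r-1 h p q = <⇒≤∸1 (≤∧≢⇒< p q)

  module ChainGaps (B : ℕ → SubSet) (ch : IsRChain n lam B) where
    open RChain B ch

    B-≤n : ∀ h → h ≤ suc r′ → ∀ x → B h x ≡ true → x ≤ n
    B-≤n h p x e = proj₂ (B-bounded h p x e)

    ChainGap-upTo-r : ChainGap B → ∀ h → 1 ≤ h → h ≤ r′ → ∀ x y z → B h x ≡ true → B (suc h) y ≡ true → B h y ≡ false →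
               y ≤ z → z ≤ x → B (suc h) z ≡ true
    ChainGap-upTo-r g h a hb x y z ex ey ny yz zx with h ≟ r′
    ... | no ne = g h a (h≤r-1 h hb ne) x y z ex ey ny yz zx
    ... | yes refl = B-top-∈ z (≤-trans (proj₁ (B-bounded (suc r′) ≤-refl y ey)) yz) (≤-trans zx (B-≤n r′ (n≤1+n r′) x ex))

    -- A non-member z between a new y and some x ∈ B h would put x in a clump after L_e, i.e. make x new.
    RCD⇒ChainGap : RCDCondition B → ChainGap B
    RCD⇒ChainGap rc h a hb x y z ex ey ny yz zx with B (suc h) z in ez
    ... | true = refl
    ... | false with rc h a (≤-trans hb (m∸n≤m r′ 1))
    ...   | a0 , _ , _ , from , after
            with from y ey ny
               | clump-of n (B (suc h)) (B-≤n (suc h) (s≤s (≤-trans hb (m∸n≤m r′ 1)))) x (B-nested h (≤-trans hb (m∸n≤m r′ 1)) x ex)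
    ...     | a1 , b1 , cl1 , a0≤a1 , a1≤y , _ | a2 , b2 , cl2 , a2≤x , x≤b2 =
      ⊥-elim (true≢false (trans (sym ex) (proj₂ (after x (a2 , b2 , cl2 , a0<a2 , a2≤x , x≤b2)))))
      where
      b1<z : b1 < z
      b1<z with b1 <? z
      ... | yes t = t
      ... | no t = ⊥-elim (true≢false (trans (sym (clump-∈ _ a1 b1 cl1 z (≤-trans a1≤y yz) (≮⇒≥ t))) ez))
      z<a2 : z < a2
      z<a2 with z <? a2
      ... | yes t = t
      ... | no t = ⊥-elim (true≢false (trans (sym (clump-∈ _ a2 b2 cl2 z (≮⇒≥ t) (≤-trans zx x≤b2))) ez))
      a0<a2 : a0 < a2
      a0<a2 = ≤-<-trans a0≤a1 (≤-<-trans (proj₁ cl1) (<-trans b1<z z<a2))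

    least-new : ∀ h → h ≤ r′ →
                ∃[ y ] (B (suc h) y ≡ true × B h y ≡ false × (∀ z → z < y → (B (suc h) z ∧ not (B h z)) ≡ false))
    least-new h hb with countTo-<⇒∃∉ (B h) (B (suc h)) (B-nested h hb) n
                          (subst₂ _<_ (sym (B-count h (≤-trans hb (n≤1+n r′)))) (sym (B-count (suc h) (s≤s hb))) (Q-< h hb))
    ... | y , _ , _ , ey , ny with least (λ x → B (suc h) x ∧ not (B h x)) y (∧≡true ey (not≡true ny))
    ...   | y0 , new , _ , below = y0 , proj₁ (∧≡true⇒ {B (suc h) y0} new) , not≡true⇒ (proj₂ (∧≡true⇒ {B (suc h) y0} new)) , below

    -- The clump L_e is the one containing the least element of B (h+1) ∖ B h.
    ChainGap⇒RCD : ChainGap B → RCDCondition B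
    ChainGap⇒RCD g h a hb with least-new h hb
    ... | y0 , ey0 , ny0 , y0min with clump-of n (B (suc h)) (B-≤n (suc h) (s≤s hb)) y0 ey0
    ...   | a0 , b0 , cl0 , a0y0 , y0b0 = a0 , b0 , cl0 , from , after
      where
      bd1 = B-≤n (suc h) (s≤s hb)
      from : ∀ x → B (suc h) x ≡ true → B h x ≡ false → InClumpsFrom (B (suc h)) a0 x
      from x ex nx with clump-of n (B (suc h)) bd1 x ex
      ... | a' , b' , cl' , a'x , xb' = a' , b' , cl' , a0a' , a'x , xb'
        where
        y0x : y0 ≤ x
        y0x with y0 ≤? x
        ... | yes t = t
        ... | no t = ⊥-elim (true≢false (trans (sym (∧≡true ex (not≡true nx))) (y0min x (≰⇒> t))))
        a0a' : a0 ≤ a'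
        a0a' with a0 ≤? a'
        ... | yes t = t
        ... | no t = ⊥-elim (<⇒≱ (clump-order _ a' b' a0 b0 cl' cl0 (≰⇒> t)) (≤-trans a0y0 (≤-trans y0x xb')))
      after : ∀ x → InClumpsAfter (B (suc h)) a0 x → B (suc h) x ≡ true × B h x ≡ false
      after x (a' , b' , cl' , a0a' , a'x , xb') = ex , nx
        where
        ex = clump-∈ _ a' b' cl' x a'x xb'
        nx : B h x ≡ false
        nx with B h x in e
        ... | false = refl
        ... | true = ⊥-elim (true≢false (trans (sym (ChainGap-upTo-r g h a hb x y0 (suc b0) e ey0 ny0 (≤-trans y0b0 (n≤1+n b0))
                                                  (≤-trans (clump-order _ a0 b0 a' b' cl0 cl' a0a') a'x)))
                                    (clump-after-∉ _ a0 b0 cl0)))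

  module PermChain (π : ℕ → ℕ) (pm : IsPerm n lam π) where
    pbd : ∀ i → 1 ≤ i → i ≤ n → 1 ≤ π i × π i ≤ n
    pbd = proj₁ pm

    pinj : ∀ i j → 1 ≤ i → i ≤ n → 1 ≤ j → j ≤ n → π i ≡ π j → i ≡ j
    pinj = proj₂ pm

    firstSet-π-n⊆full : firstSet π n ⊆ fullSet n
    firstSet-π-n⊆full x e with firstSet-∈⁻ π n x e
    ... | i , a , b , refl = fullSet-∈ n (π i) (proj₁ (pbd i a b)) (proj₂ (pbd i a b))

    firstSet-π-n : ∀ x → firstSet π n x ≡ fullSet n x
    firstSet-π-n = ⊆∧countTo≡⇒≡ n (firstSet π n) (fullSet n) firstSet-π-n⊆full
                     (trans (countTo-firstSet n π n pbd pinj) (sym (countTo-fullSet n))) (fullSet-∈⁻ n)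

    chainOf-RChain : IsRChain n lam (chainOf n lam π)
    chainOf-RChain = (λ x → refl) , c2 , c3 , c4 , c5
      where
      c2 : ∀ x → firstSet π (Q (suc r′)) x ≡ fullSet n x
      c2 x = trans (cong (λ k → firstSet π k x) Q-top) (firstSet-π-n x)
      c3 : ∀ h → h ≤ suc r′ → ∀ x → firstSet π (Q h) x ≡ true → 1 ≤ x × x ≤ n
      c3 h p x e with firstSet-∈⁻ π (Q h) x e
      ... | i , a , b , refl = pbd i a (≤-trans b (Q≤n h p))
      c4 : ∀ h → h ≤ r′ → ∀ x → firstSet π (Q h) x ≡ true → firstSet π (Q (suc h)) x ≡ true
      c4 h p = firstSet-mono π (Q h) (Q (suc h)) (<⇒≤ (Q-< h p))
      c5 : ∀ h → h ≤ suc r′ → countTo (firstSet π (Q h)) n ≡ Q h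
      c5 h p = countTo-firstSet n π (Q h) (λ i a b → pbd i a (≤-trans b (Q≤n h p)))
                 (λ i j a b c d → pinj i j a (≤-trans b (Q≤n h p)) c (≤-trans d (Q≤n h p)))

    -- A 312-pattern π b < π c < π a with a ≤ Q h < b ≤ Q (h+1) < c is exactly a gap:
    -- π b is new in B (h+1), π a ∈ B h, and π c lies between them but outside B (h+1).
    ChainGap⇒¬312 : ChainGap (chainOf n lam π) → ¬ Contains312 n lam π
    ChainGap⇒¬312 g (h , a , b , c , (h1 , h2) , (a1 , a2 , b1 , b2 , c1 , c2) , (l1 , l2)) with firstSet-∈⁻ π (Q (suc h)) (π c) gz
      where
      hr : h ≤ r′
      hr = ≤-trans h2 (m∸n≤m r′ 1)
      bn : b ≤ n
      bn = ≤-trans b2 (Q≤n (suc h) (s≤s hr))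
      b≥1 : 1 ≤ b
      b≥1 = ≤-trans (s≤s z≤n) b1
      ny : firstSet π (Q h) (π b) ≡ false
      ny = firstSet-∉ π (Q h) (π b) (λ i p s e → <⇒≱ b1 (subst (_≤ Q h) (pinj i b p (≤-trans s (Q≤n h (≤-trans hr (n≤1+n r′)))) b≥1 bn e) s))
      gz : firstSet π (Q (suc h)) (π c) ≡ true
      gz = g h h1 h2 (π a) (π b) (π c) (firstSet-∈ π (Q h) a a1 a2) (firstSet-∈ π (Q (suc h)) b b≥1 b2) ny (<⇒≤ l1) (<⇒≤ l2)
    ... | i , p , s , e = <⇒≱ c1 (subst (_≤ Q (suc h)) (pinj i c p (≤-trans s (Q≤n (suc h) (s≤s (≤-trans h2 (m∸n≤m r′ 1))))) (≤-trans (s≤s z≤n) c1) c2 e) s)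

    ¬312⇒ChainGap : ¬ Contains312 n lam π → ChainGap (chainOf n lam π)
    ¬312⇒ChainGap n3 h a hb x y z ex ey ny yz zx with firstSet π (Q (suc h)) z in ez
    ... | true = refl
    ... | false with firstSet-∈⁻ π (Q h) x ex | firstSet-∈⁻ π (Q (suc h)) y ey
    ...   | ia , ia1 , ia2 , refl | ib , ib1 , ib2 , refl
            with firstSet-∈⁻ π n z (trans (firstSet-π-n z) (fullSet-∈ n z (≤-trans (proj₁ (pbd ib ib1 (≤-trans ib2 (Q≤n (suc h) (s≤s hr))))) yz)
                                                                        (≤-trans zx (proj₂ (pbd ia ia1 (≤-trans ia2 (Q≤n h (≤-trans hr (n≤1+n r′)))))))))
      where
      hr : h ≤ r′
      hr = ≤-trans hb (m∸n≤m r′ 1)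
    ...     | ic , ic1 , ic2 , refl = ⊥-elim (n3 (h , ia , ib , ic , (a , hb) , (ia1 , ia2 , Qh<ib , ib2 , Qsh<ic , ic2) , (πb<πc , πc<πa)))
      where
      hr : h ≤ r′
      hr = ≤-trans hb (m∸n≤m r′ 1)
      Qh<ib : Q h < ib
      Qh<ib = ≰⇒> (λ ib≤Qh → true≢false (trans (sym (firstSet-∈ π (Q h) ib ib1 ib≤Qh)) ny))
      Qsh<ic : Q (suc h) < ic
      Qsh<ic = ≰⇒> (λ ic≤Qsh → true≢false (trans (sym (firstSet-∈ π (Q (suc h)) ic ic1 ic≤Qsh)) ez))
      πb<πc : π ib < π ic
      πb<πc = ≤∧≢⇒< yz (λ e → true≢false (trans (sym ey) (trans (cong (firstSet π (Q (suc h))) e) ez)))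
      πc<πa : π ic < π ia
      πc<πa = ≤∧≢⇒< zx (λ e → true≢false (trans (sym (firstSet-mono π (Q h) (Q (suc h)) (<⇒≤ (Q-< h hr)) (π ia) ex))
                                                 (trans (cong (firstSet π (Q (suc h))) (sym e)) ez)))

  ChainGap-cong : ∀ B B' → (∀ h → h ≤ suc r′ → ∀ x → B h x ≡ B' h x) → ChainGap B → ChainGap B'
  ChainGap-cong B B' eq g h a hb x y z ex ey ny yz zx =
    trans (sym (eq (suc h) h1 z)) (g h a hb x y z (trans (eq h h0 x) ex) (trans (eq (suc h) h1 y) ey) (trans (eq h h0 y) ny) yz zx)
    where
    h0 : h ≤ suc r′
    h0 = ≤-trans hb (≤-trans (m∸n≤m r′ 1) (n≤1+n r′))
    h1 : suc h ≤ suc r′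
    h1 = s≤s (≤-trans hb (m∸n≤m r′ 1))

  ChainGap⇒avoiding-πOf : ∀ B (ch : IsRChain n lam B) → ChainGap B → Avoids312 n lam (RChain.πOf B ch)
  ChainGap⇒avoiding-πOf B ch cg =
    πOf-SnR , PermChain.ChainGap⇒¬312 πOf πOf-IsPerm (ChainGap-cong B (chainOf n lam πOf) (λ h p x → sym (chainOf-πOf h p x)) cg)
    where open RChain B ch

module Keys (n : ℕ) (lam : ℕ → ℕ) (n≥1 : 1 ≤ n) (part : IsPartition n lam) where

  open Shape n lam n≥1 part
  open Chains n lam n≥1 part

  carrel′-mono : ∀ i i' → 1 ≤ i → i ≤ i' → i' ≤ n → carrel′ i ≤ carrel′ i'
  carrel′-mono i i' a b c = subst₂ _≤_ (sym (carrel′≡ i a (≤-trans b c))) (sym (carrel′≡ i' (≤-trans a b) c)) (s≤s (countTo-mono inR (∸-monoˡ-≤ 1 b)))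

  carrel′-ζ-spec : ∀ j → 1 ≤ j → j ≤ lam 1 → 1 ≤ carrel′ (ζ j) × carrel′ (ζ j) ≤ suc r′ × Q (carrel′ (ζ j)) ≡ ζ j
  carrel′-ζ-spec j a b = let cs = carrel′-spec (ζ j) (ζ-pos j b) (ζ≤n j) in proj₁ cs , proj₁ (proj₂ cs) , Q-carrel′-ζ j a b

  Q-column : ∀ h → 1 ≤ h → h ≤ r′ → Σ ℕ λ j → 1 ≤ j × j ≤ lam 1 × ζ j ≡ Q h
  Q-column h a b = inR⇒column (Q h) (proj₁ (Q-spec h a b))

  carrel′-Q : ∀ h → 1 ≤ h → h ≤ suc r′ → carrel′ (Q h) ≡ h
  carrel′-Q h a b = carrel′-unique h (Q h) a b (Q-mono-< (h ∸ 1) h (≤∸1⇒< ≤-refl a) b) ≤-refl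

  module Portrayal (Bc : ℕ → SubSet) (ch : IsRChain n lam Bc) where
    open RChain Bc ch

    portrayal-column : ∀ j → 1 ≤ j → j ≤ lam 1 → ∀ i → portrayal n lam Bc j i ≡ column n (Bc (carrel′ (ζ j))) i
    portrayal-column j a b i with carrel′-ζ-spec j a b
    ... | (h1 , h2 , hq) with m≤n⇒m<n∨m≡n h2
    ...   | inj₁ t = cong (λ f → f i) (portrayal-middle Bc j (carrel′ (ζ j)) a b h1 (s≤s⁻¹ t) (sym hq))
    ...   | inj₂ e = trans (cong (λ f → f i) (portrayal-full Bc j a jn))
                       (trans (column-ext n _ _ (λ x _ _ → sym (B-top x)) i) (cong (λ h → column n (Bc h) i) (sym e)))
      where
      jn : j ≤ lam n
      jn = ≤ζ⇒≤lam j n n≥1 ≤-refl (≤-reflexive (trans (sym (trans (cong Q e) Q-top)) hq))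

    countTo-carrel′-ζ : ∀ j → 1 ≤ j → j ≤ lam 1 → countTo (Bc (carrel′ (ζ j))) n ≡ ζ j
    countTo-carrel′-ζ j a b = let (_ , h2 , hq) = carrel′-ζ-spec j a b in trans (B-count _ h2) hq

    portrayal-InT : InT n lam (portrayal n lam Bc)
    portrayal-InT = t1 , t2 , t3
      where
      t1 : ∀ j i → Box n lam j i → 1 ≤ portrayal n lam Bc j i × portrayal n lam Bc j i ≤ n
      t1 j i (a , b , c , d) with column-spec n (Bc (carrel′ (ζ j))) i c (subst (i ≤_) (sym (countTo-carrel′-ζ j a b)) d)
      ... | x , _ , x1 , xn , _ , cx = subst (λ w → 1 ≤ w × w ≤ n) (sym (trans (portrayal-column j a b i) cx)) (x1 , xn)
      t2 : ∀ j i → 1 ≤ j → j ≤ lam 1 → 1 ≤ i → suc i ≤ ζ j → portrayal n lam Bc j i < portrayal n lam Bc j (suc i)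
      t2 j i a b c d with column-spec n (Bc (carrel′ (ζ j))) i c (subst (i ≤_) (sym (countTo-carrel′-ζ j a b)) (≤-trans (n≤1+n i) d))
                        | column-spec n (Bc (carrel′ (ζ j))) (suc i) (s≤s z≤n) (subst (suc i ≤_) (sym (countTo-carrel′-ζ j a b)) d)
      ... | x , _ , _ , _ , kx , cx | x' , _ , _ , _ , kx' , cx' =
        subst₂ _<_ (sym (trans (portrayal-column j a b i) cx)) (sym (trans (portrayal-column j a b (suc i)) cx'))
          (countTo-<⇒< (Bc (carrel′ (ζ j))) (subst₂ _<_ (sym kx) (sym kx') ≤-refl))
      t3 : ∀ j i → 1 ≤ j → suc j ≤ lam 1 → 1 ≤ i → i ≤ ζ (suc j) → portrayal n lam Bc j i ≤ portrayal n lam Bc (suc j) i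
      t3 j i a b c d = subst₂ _≤_ (sym (portrayal-column j a (≤-trans (n≤1+n j) b) i)) (sym (portrayal-column (suc j) (s≤s z≤n) b i))
                         (column-antitone n (Bc (carrel′ (ζ (suc j)))) (Bc (carrel′ (ζ j))) sub i c (subst (i ≤_) (sym (countTo-carrel′-ζ (suc j) (s≤s z≤n) b)) d))
        where
        hle : carrel′ (ζ (suc j)) ≤ carrel′ (ζ j)
        hle = carrel′-mono (ζ (suc j)) (ζ j) (ζ-pos (suc j) b) (ζ-antitone j (suc j) (n≤1+n j)) (ζ≤n j)
        sub : Bc (carrel′ (ζ (suc j))) ⊆ Bc (carrel′ (ζ j))
        sub = B-mono _ _ hle (proj₁ (proj₂ (carrel′-ζ-spec j a (≤-trans (n≤1+n j) b))))

    colSet-portrayal : ∀ j → 1 ≤ j → j ≤ lam 1 → ∀ x → colSet n lam (portrayal n lam Bc) j x ≡ Bc (carrel′ (ζ j)) x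
    colSet-portrayal j a b x = trans (firstSet-ext _ (column n (Bc (carrel′ (ζ j)))) (ζ j) (λ i _ _ → portrayal-column j a b i) x)
                           (trans (cong (λ k → firstSet (column n (Bc (carrel′ (ζ j)))) k x) (sym (countTo-carrel′-ζ j a b)))
                             (firstSet-column n _ (B-bounded _ (proj₁ (proj₂ (carrel′-ζ-spec j a b)))) x))

    portrayal-IsKey : IsKey n lam (portrayal n lam Bc)
    portrayal-IsKey = portrayal-InT , λ l j a b c x e → subst (_≡ true) (sym (colSet-portrayal l a (≤-trans b c) x))
                (B-mono _ _ (carrel′-mono (ζ j) (ζ l) (ζ-pos j c) (ζ-antitone l j b) (ζ≤n l)) (proj₁ (proj₂ (carrel′-ζ-spec l a (≤-trans b c))))
                   x (subst (_≡ true) (colSet-portrayal j (≤-trans a b) c x) e))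

    InColsOfLen-portrayal : ∀ h → 1 ≤ h → h ≤ r′ → ∀ x →
                            (InColsOfLen n lam (portrayal n lam Bc) (Q h) x → Bc h x ≡ true) ×
                            (Bc h x ≡ true → InColsOfLen n lam (portrayal n lam Bc) (Q h) x)
    InColsOfLen-portrayal h a b x = f , g
      where
      f : InColsOfLen n lam (portrayal n lam Bc) (Q h) x → Bc h x ≡ true
      f (j , j1 , j2 , zj , e) = subst (λ w → Bc w x ≡ true) (trans (cong carrel′ zj) (carrel′-Q h a (≤-trans b (n≤1+n r′)))) (trans (sym (colSet-portrayal j j1 j2 x)) e)
      g : Bc h x ≡ true → InColsOfLen n lam (portrayal n lam Bc) (Q h) x
      g e with Q-column h a b
      ... | j , j1 , j2 , zj =
        j , j1 , j2 , zj , trans (colSet-portrayal j j1 j2 x) (subst (λ w → Bc w x ≡ true) (sym (trans (cong carrel′ zj) (carrel′-Q h a (≤-trans b (n≤1+n r′))))) e)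

  GaplessPart : (ℕ → ℕ → ℕ) → Set
  GaplessPart Y = ∀ h → 1 ≤ h → h ≤ r′ ∸ 1 → ∀ b m →
         IsLeast (λ x → InColsOfLen n lam Y (Q (suc h)) x × ¬ InColsOfLen n lam Y (Q h) x) b →
         IsGreatest (InColsOfLen n lam Y (Q h)) m →
         b < m → ∀ x → b ≤ x → x ≤ m → InColsOfLen n lam Y (Q (suc h)) x

  suc≤r′ : ∀ h → 1 ≤ h → h ≤ r′ ∸ 1 → suc h ≤ r′
  suc≤r′ h a b with r′
  ... | zero = ⊥-elim (<⇒≱ a b)
  ... | suc r' = s≤s b

  module ColumnsOf (Y : ℕ → ℕ → ℕ) (S : ℕ → SubSet)
    (S≡columns : ∀ h → 1 ≤ h → h ≤ r′ → ∀ x → (InColsOfLen n lam Y (Q h) x → S h x ≡ true) × (S h x ≡ true → InColsOfLen n lam Y (Q h) x))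
    (S-≤n : ∀ h → 1 ≤ h → h ≤ r′ → ∀ x → S h x ≡ true → x ≤ n) where

    ChainGap⇒GaplessPart : ChainGap S → GaplessPart Y
    ChainGap⇒GaplessPart cg h a hb b m (lb , _) (gm , _) bm x bx xm =
      proj₂ (S≡columns (suc h) (s≤s z≤n) h1 x) (cg h a hb m b x (proj₁ (S≡columns h a hr m) gm) (proj₁ (S≡columns (suc h) (s≤s z≤n) h1 b) (proj₁ lb)) nb bx xm)
      where
      h1 = suc≤r′ h a hb
      hr : h ≤ r′
      hr = ≤-trans (n≤1+n h) h1
      nb : S h b ≡ false
      nb = ≢true⇒≡false (λ e → proj₂ lb (proj₂ (S≡columns h a hr b) e))

    least-new-IsLeast : ∀ h → 1 ≤ h → suc h ≤ r′ → ∀ b → (S (suc h) b ∧ not (S h b)) ≡ true →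
                        (∀ z → z < b → (S (suc h) z ∧ not (S h z)) ≡ false) →
                        IsLeast (λ x → InColsOfLen n lam Y (Q (suc h)) x × ¬ InColsOfLen n lam Y (Q h) x) b
    least-new-IsLeast h a h1 b new below =
      (proj₂ (S≡columns (suc h) (s≤s z≤n) h1 b) (proj₁ (∧≡true⇒ {S (suc h) b} new)) ,
       λ ic → true≢false (trans (sym (proj₁ (S≡columns h a hr b) ic)) (not≡true⇒ (proj₂ (∧≡true⇒ {S (suc h) b} new))))) ,
      λ y (in-suc , ∉h) → ≮⇒≥ (λ y<b → true≢false
        (trans (sym (∧≡true (proj₁ (S≡columns (suc h) (s≤s z≤n) h1 y) in-suc)
                            (not≡true (≢true⇒≡false (λ e → ∉h (proj₂ (S≡columns h a hr y) e))))))
               (below y y<b)))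
      where
      hr : h ≤ r′
      hr = ≤-trans (n≤1+n h) h1

    greatest-IsGreatest : ∀ h → 1 ≤ h → h ≤ r′ → ∀ m → S h m ≡ true → (∀ z → m < z → z ≤ n → S h z ≡ false) →
                          IsGreatest (InColsOfLen n lam Y (Q h)) m
    greatest-IsGreatest h a hr m em above =
      proj₂ (S≡columns h a hr m) em ,
      λ y ic → ≮⇒≥ (λ m<y → true≢false (trans (sym (proj₁ (S≡columns h a hr y) ic))
                                               (above y m<y (S-≤n h a hr y (proj₁ (S≡columns h a hr y) ic)))))

    ≤greatest : ∀ h → 1 ≤ h → h ≤ r′ → ∀ x m → S h x ≡ true → (∀ z → m < z → z ≤ n → S h z ≡ false) → x ≤ m
    ≤greatest h a hr x m ex above = ≮⇒≥ (λ m<x → true≢false (trans (sym ex) (above x m<x (S-≤n h a hr x ex))))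

    GaplessPart⇒ChainGap : GaplessPart Y → ChainGap S
    GaplessPart⇒ChainGap gk h a hb x y z ex ey ny yz zx
      with least (λ w → S (suc h) w ∧ not (S h w)) y (∧≡true ey (not≡true ny)) | greatest (S h) n
    ... | _ | inj₂ none = ⊥-elim (true≢false (trans (sym ex) (none x (S-≤n h a (≤-trans (n≤1+n h) (suc≤r′ h a hb)) x ex))))
    ... | b , new , b≤y , below | inj₁ (m , em , _ , above) with b <? m
    ...   | yes b<m = proj₁ (S≡columns (suc h) (s≤s z≤n) (suc≤r′ h a hb) z)
                        (gk h a hb b m (least-new-IsLeast h a (suc≤r′ h a hb) b new below)
                            (greatest-IsGreatest h a (≤-trans (n≤1+n h) (suc≤r′ h a hb)) m em above)
                            b<m z (≤-trans b≤y yz) (≤-trans zx (≤greatest h a (≤-trans (n≤1+n h) (suc≤r′ h a hb)) x m ex above)))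
    ...   | no b≮m = subst (λ w → S (suc h) w ≡ true)
                           (≤-antisym (≤-trans b≤y yz) (≤-trans zx (≤-trans (≤greatest h a (≤-trans (n≤1+n h) (suc≤r′ h a hb)) x m ex above) (≮⇒≥ b≮m))))
                           (proj₁ (∧≡true⇒ {S (suc h) b} new))

  column-of-length-Q : ∀ h → 1 ≤ h → h ≤ r′ → 1 ≤ lam (Q h) × lam (Q h) ≤ lam 1 × ζ (lam (Q h)) ≡ Q h
  column-of-length-Q h a b = l1 , l2 , trans (ζ-lam≡Q-carrel′ (Q h) qp qn l1) (cong Q (carrel′-Q h a (≤-trans b (n≤1+n r′))))
    where
    ce = Q-column h a b
    qp = Q-pos h a (≤-trans b (n≤1+n r′))
    qn = Q≤n h (≤-trans b (n≤1+n r′))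
    l1 : 1 ≤ lam (Q h)
    l1 = ≤-trans (proj₁ (proj₂ ce)) (≤ζ⇒≤lam (proj₁ ce) (Q h) qp qn (≤-reflexive (sym (proj₂ (proj₂ (proj₂ ce))))))
    l2 : lam (Q h) ≤ lam 1
    l2 = lam-antitone 1 (Q h) ≤-refl qp qn

  chainOfKey : (ℕ → ℕ → ℕ) → ℕ → SubSet
  chainOfKey Y zero = λ _ → false
  chainOfKey Y (suc h) = if (suc h ≤ᵇ r′) then colSet n lam Y (lam (Q (suc h))) else fullSet n

  chainOfKey-middle : ∀ Y h → 1 ≤ h → h ≤ r′ → chainOfKey Y h ≡ colSet n lam Y (lam (Q h))
  chainOfKey-middle Y (suc h) a b rewrite ≤⇒≤ᵇ≡true b = refl

  chainOfKey-top : ∀ Y → chainOfKey Y (suc r′) ≡ fullSet n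
  chainOfKey-top Y rewrite >⇒≤ᵇ≡false {suc r′} {r′} ≤-refl = refl

  module KeyChain (Y : ℕ → ℕ → ℕ) (ky : IsKey n lam Y) where
    BY : ℕ → SubSet
    BY = chainOfKey Y

    Ybd : ∀ j i → Box n lam j i → 1 ≤ Y j i × Y j i ≤ n
    Ybd = proj₁ (proj₁ ky)

    nestY : ∀ l j → 1 ≤ l → l ≤ j → j ≤ lam 1 → colSet n lam Y j ⊆ colSet n lam Y l
    nestY = proj₂ ky

    colSet-bounded : ∀ j → 1 ≤ j → j ≤ lam 1 → ∀ x → colSet n lam Y j x ≡ true → 1 ≤ x × x ≤ n
    colSet-bounded j a b x e with firstSet-∈⁻ (Y j) (ζ j) x e
    ... | i , c , d , refl = Ybd j i (a , b , c , d)

    column-strict : ∀ j → 1 ≤ j → j ≤ lam 1 → StrictOn (Y j) (ζ j)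
    column-strict j a b i c d = proj₁ (proj₂ (proj₁ ky)) j i a b c d

    countTo-colSet : ∀ j → 1 ≤ j → j ≤ lam 1 → countTo (colSet n lam Y j) n ≡ ζ j
    countTo-colSet j a b = countTo-firstSet n (Y j) (ζ j) (λ i c d → Ybd j i (a , b , c , d)) (StrictOn-injective (Y j) (ζ j) (column-strict j a b))

    column-colSet : ∀ j → 1 ≤ j → j ≤ lam 1 → ∀ i → 1 ≤ i → i ≤ ζ j → column n (colSet n lam Y j) i ≡ Y j i
    column-colSet j a b = column-firstSet-strict n (Y j) (ζ j) (column-strict j a b) (λ i c d → Ybd j i (a , b , c , d))

    colSet-same-length : ∀ j j' → 1 ≤ j → j ≤ lam 1 → 1 ≤ j' → j' ≤ lam 1 → ζ j ≡ ζ j' → ∀ x → colSet n lam Y j x ≡ colSet n lam Y j' x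
    colSet-same-length j j' a b c d e x with ≤-total j j'
    ... | inj₁ p = sym (⊆∧countTo≡⇒≡ n _ _ (nestY j j' a p d) (trans (countTo-colSet j' c d) (trans (sym e) (sym (countTo-colSet j a b)))) (colSet-bounded j a b) x)
    ... | inj₂ p = ⊆∧countTo≡⇒≡ n _ _ (nestY j' j c p b) (trans (countTo-colSet j a b) (trans e (sym (countTo-colSet j' c d)))) (colSet-bounded j' c d) x

    colSet≡chainOfKey : ∀ j → 1 ≤ j → j ≤ lam 1 → ∀ x → colSet n lam Y j x ≡ BY (carrel′ (ζ j)) x
    colSet≡chainOfKey j a b x with carrel′-ζ-spec j a b
    ... | (h1 , h2 , hq) with m≤n⇒m<n∨m≡n h2
    ...   | inj₁ t = let h = carrel′ (ζ j) ; hr = s≤s⁻¹ t ; (l1 , l2 , l3) = column-of-length-Q h h1 hr in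
                     trans (colSet-same-length j (lam (Q h)) a b l1 l2 (trans (sym hq) (sym l3)) x) (cong (λ f → f x) (sym (chainOfKey-middle Y h h1 hr)))
    ...   | inj₂ e = trans (⊆∧countTo≡⇒≡ n _ _ (λ y ey → fullSet-∈ n y (proj₁ (colSet-bounded j a b y ey)) (proj₂ (colSet-bounded j a b y ey)))
                            (trans (countTo-colSet j a b) (trans (sym hq) (trans (cong Q e) (trans Q-top (sym (countTo-fullSet n))))))
                            (λ y ey → fullSet-∈⁻ n y ey) x)
                        (cong (λ f → f x) (sym (trans (cong BY e) (chainOfKey-top Y))))

    chainOfKey-RChain : IsRChain n lam BY
    chainOfKey-RChain = (λ x → refl) , (λ x → cong (λ f → f x) (chainOfKey-top Y)) , c3 , c4 , c5
      where
      c3 : ∀ h → h ≤ suc r′ → ∀ x → BY h x ≡ true → 1 ≤ x × x ≤ n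
      c3 zero p x ()
      c3 (suc h) p x e with m≤n⇒m<n∨m≡n p
      ... | inj₁ t = let (l1 , l2 , _) = column-of-length-Q (suc h) (s≤s z≤n) (s≤s⁻¹ t) in
                     colSet-bounded (lam (Q (suc h))) l1 l2 x (trans (cong (λ f → f x) (sym (chainOfKey-middle Y (suc h) (s≤s z≤n) (s≤s⁻¹ t)))) e)
      ... | inj₂ q = fullSet-∈⁻ n x (trans (cong (λ f → f x) (sym (chainOfKey-top Y))) (subst (λ w → BY w x ≡ true) q e))
      c4 : ∀ h → h ≤ r′ → ∀ x → BY h x ≡ true → BY (suc h) x ≡ true
      c4 zero p x ()
      c4 (suc h) p x e with m≤n⇒m<n∨m≡n p
      ... | inj₂ q = subst (λ w → BY (suc w) x ≡ true) (sym q)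
                       (trans (cong (λ f → f x) (chainOfKey-top Y))
                              (fullSet-∈ n x (proj₁ (c3 (suc h) (≤-trans p (n≤1+n r′)) x e)) (proj₂ (c3 (suc h) (≤-trans p (n≤1+n r′)) x e))))
      ... | inj₁ t = trans (cong (λ f → f x) (chainOfKey-middle Y (suc (suc h)) (s≤s z≤n) t))
                       (nestY (lam (Q (suc (suc h)))) (lam (Q (suc h))) l1' (lam-Q-antitone (suc h) (suc (suc h)) (s≤s z≤n) (n≤1+n _) (≤-trans t (n≤1+n r′))) l2 x
                         (trans (cong (λ f → f x) (sym (chainOfKey-middle Y (suc h) (s≤s z≤n) p))) e))
        where
        l1' = proj₁ (column-of-length-Q (suc (suc h)) (s≤s z≤n) t)
        l2 = proj₁ (proj₂ (column-of-length-Q (suc h) (s≤s z≤n) p))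
      c5 : ∀ h → h ≤ suc r′ → countTo (BY h) n ≡ Q h
      c5 zero p = countTo-const _ 0 n z≤n (λ x _ _ → refl)
      c5 (suc h) p with m≤n⇒m<n∨m≡n p
      ... | inj₂ q = subst (λ w → countTo (BY w) n ≡ Q w) (sym q) (trans (cong (λ S → countTo S n) (chainOfKey-top Y)) (trans (countTo-fullSet n) (sym Q-top)))
      ... | inj₁ t = let (l1 , l2 , l3) = column-of-length-Q (suc h) (s≤s z≤n) (s≤s⁻¹ t) in
                     trans (cong (λ S → countTo S n) (chainOfKey-middle Y (suc h) (s≤s z≤n) (s≤s⁻¹ t))) (trans (countTo-colSet _ l1 l2) l3)

    portrayal-chainOfKey : TabEq n lam (portrayal n lam BY) Y
    portrayal-chainOfKey j i (a , b , c , d) = trans (Portrayal.portrayal-column BY chainOfKey-RChain j a b i)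
                                    (trans (column-ext n _ _ (λ x _ _ → sym (colSet≡chainOfKey j a b x)) i) (column-colSet j a b i c d))

    InColsOfLen-chainOfKey : ∀ h → 1 ≤ h → h ≤ r′ → ∀ x → (InColsOfLen n lam Y (Q h) x → BY h x ≡ true) × (BY h x ≡ true → InColsOfLen n lam Y (Q h) x)
    InColsOfLen-chainOfKey h a b x = f , g
      where
      f : InColsOfLen n lam Y (Q h) x → BY h x ≡ true
      f (j , j1 , j2 , zj , e) = subst (λ w → BY w x ≡ true) (trans (cong carrel′ zj) (carrel′-Q h a (≤-trans b (n≤1+n r′)))) (trans (sym (colSet≡chainOfKey j j1 j2 x)) e)
      g : BY h x ≡ true → InColsOfLen n lam Y (Q h) x
      g e = let (l1 , l2 , l3) = column-of-length-Q h a b in lam (Q h) , l1 , l2 , l3 , trans (cong (λ f → f x) (sym (chainOfKey-middle Y h a b))) e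

  portrayal-injective : ∀ B B' → IsRChain n lam B → IsRChain n lam B' →
                        TabEq n lam (portrayal n lam B) (portrayal n lam B') → ChainEq n lam B B'
  portrayal-injective B B' ch ch' te h hs x with m≤n⇒m<n∨m≡n hs
  ... | inj₂ refl = trans (RChain.B-top B ch x) (sym (RChain.B-top B' ch' x))
  ... | inj₁ t with h
  ...   | zero = trans (RChain.B₀-empty B ch x) (sym (RChain.B₀-empty B' ch' x))
  ...   | suc h with Q-column (suc h) (s≤s z≤n) (s≤s⁻¹ t)
  ...     | j , j1 , j2 , ζj≡Q =
    ≡true⇔⇒≡ (sameColumn⇒⊆ n (B (suc h)) (B' (suc h)) (Q (suc h)) (RChain.B-count B ch (suc h) hs) (RChain.B-count B' ch' (suc h) hs)
                         (RChain.B-bounded B ch (suc h) hs) same-column x)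
             (sameColumn⇒⊆ n (B' (suc h)) (B (suc h)) (Q (suc h)) (RChain.B-count B' ch' (suc h) hs) (RChain.B-count B ch (suc h) hs)
                         (RChain.B-bounded B' ch' (suc h) hs) (λ i a b → sym (same-column i a b)) x)
    where
    carrel-j : carrel′ (ζ j) ≡ suc h
    carrel-j = trans (cong carrel′ ζj≡Q) (carrel′-Q (suc h) (s≤s z≤n) hs)
    same-column : ∀ i → 1 ≤ i → i ≤ Q (suc h) → column n (B (suc h)) i ≡ column n (B' (suc h)) i
    same-column i a b = trans (cong (λ w → column n (B w) i) (sym carrel-j))
                          (trans (sym (Portrayal.portrayal-column B ch j j1 j2 i))
                            (trans (te j i (j1 , j2 , a , subst (i ≤_) (sym ζj≡Q) b))
                              (trans (Portrayal.portrayal-column B' ch' j j1 j2 i) (cong (λ w → column n (B' w) i) carrel-j))))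

module Maximal (n : ℕ) (lam : ℕ → ℕ) (n≥1 : 1 ≤ n) (part : IsPartition n lam) where

  open Shape n lam n≥1 part
  open Chains n lam n≥1 part
  open Keys n lam n≥1 part

  InT-column-gap : ∀ T → InT n lam T → ∀ j → 1 ≤ j → j ≤ lam 1 → ∀ i k → 1 ≤ i → i ≤ k → k ≤ ζ j → T j i + k ≤ T j k + i
  InT-column-gap T tT j a b i k c d e with m≤n⇒m<n∨m≡n d
  ... | inj₂ refl = ≤-refl
  ... | inj₁ t with k
  ...   | suc k' = subst (_≤ T j (suc k') + i) (sym (+-suc (T j i) k'))
                     (≤-trans (s≤s (InT-column-gap T tT j a b i k' c (s≤s⁻¹ t) (≤-trans (n≤1+n k') e)))
                              (+-monoˡ-≤ i (proj₁ (proj₂ tT) j k' a b (≤-trans c (s≤s⁻¹ t)) e)))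

  InT-row-mono : ∀ T → InT n lam T → ∀ j j' i → 1 ≤ j → j ≤ j' → j' ≤ lam 1 → 1 ≤ i → i ≤ ζ j' → T j i ≤ T j' i
  InT-row-mono T tT j j' i a b c d e with m≤n⇒m<n∨m≡n b
  ... | inj₂ refl = ≤-refl
  ... | inj₁ t with j'
  ...   | suc j'' = ≤-trans (InT-row-mono T tT j j'' i a (s≤s⁻¹ t) (≤-trans (n≤1+n j'') c) d (≤-trans e (ζ-antitone j'' (suc j'') (n≤1+n j''))))
                      (proj₂ (proj₂ tT) j'' i (≤-trans a (s≤s⁻¹ t)) c d e)

  module PsiOf (π : ℕ → ℕ) (snr : SnR n lam π) where
    open PermChain π (proj₁ snr) public

    Bπ : ℕ → SubSet
    Bπ = chainOf n lam π

    chπ : IsRChain n lam Bπ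
    chπ = chainOf-RChain

    open RChain Bπ chπ

    Psi≡column : ∀ i → 1 ≤ i → i ≤ n → Psi n lam π i ≡ column n (Bπ (carrel′ i)) i
    Psi≡column i a b = trans (rank≡column n (Q c ∸ i) (Bπ c) (subst (Q c ∸ i <_) (sym cc) (∸-monoʳ-< a (proj₂ (proj₂ (proj₂ cs))))))
                      (cong (column n (Bπ c)) (trans (cong (_∸ (Q c ∸ i)) cc) (m∸[m∸n]≡n (proj₂ (proj₂ (proj₂ cs))))))
      where
      c = carrel′ i
      cs = carrel′-spec i a b
      cc : countTo (Bπ c) n ≡ Q c
      cc = B-count c (proj₁ (proj₂ cs))
  module GaplessChain (B : ℕ → SubSet) (ch : IsRChain n lam B) (cg : ChainGap B) where
    open RChain B ch
    open ChainGaps B ch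

    -- B (suc h) ⊇ [y, m] for y ∈ B (suc h) ∖ B h and m ∈ B h, so from y on its elements are consecutive up to m.
    countTo-consecutive : ∀ h → 1 ≤ h → h ≤ r′ → ∀ y m → B (suc h) y ≡ true → B h y ≡ false → B h m ≡ true →
                          ∀ x t → y ≤ x → x + t ≤ m →
                          B (suc h) (x + t) ≡ true × countTo (B (suc h)) (x + t) ≡ countTo (B (suc h)) x + t
    countTo-consecutive h a hr y m ey ny em x t yx xtm =
      run (x + t) (≤-trans yx (m≤m+n x t)) xtm ,
      trans (countTo-interval (B (suc h)) x (x + t) (m≤m+n x t) (λ z p q → run z (≤-trans yx (<⇒≤ p)) (≤-trans q xtm)))
            (cong (countTo (B (suc h)) x +_) (m+n∸m≡n x t))
      where
      run : ∀ z → y ≤ z → z ≤ m → B (suc h) z ≡ true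
      run z = ChainGap-upTo-r cg h a hr m y z em ey ny

    column-consecutive : ∀ h → 1 ≤ h → h ≤ r′ → ∀ y m → B (suc h) y ≡ true → B h y ≡ false → B h m ≡ true →
                         ∀ x t → y ≤ x → x + t ≤ m → column n (B (suc h)) (countTo (B (suc h)) x + t) ≡ x + t
    column-consecutive h a hr y m ey ny em x t yx xtm =
      subst (λ j → column n (B (suc h)) j ≡ x + t) counts
            (column-countTo n (B (suc h)) (x + t) ∈B (≤-trans (proj₁ (B-bounded (suc h) (s≤s hr) y ey)) (≤-trans yx (m≤m+n x t)))
                                                     (≤-trans xtm (proj₂ (B-bounded h (≤-trans hr (n≤1+n r′)) m em))))
      where
      ∈B = proj₁ (countTo-consecutive h a hr y m ey ny em x t yx xtm)
      counts = proj₂ (countTo-consecutive h a hr y m ey ny em x t yx xtm)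

    new-below-column : ∀ h → h ≤ r′ → ∀ i → 1 ≤ i → i ≤ Q h → column n (B h) i ≢ column n (B (suc h)) i →
                       ∃[ y ] (1 ≤ y × y ≤ column n (B (suc h)) i × B (suc h) y ≡ true × B h y ≡ false)
    new-below-column h hr i i1 iQ ne
      with column-spec n (B (suc h)) i i1 (subst (i ≤_) (sym (B-count (suc h) (s≤s hr))) (≤-trans iQ (<⇒≤ (Q-< h hr))))
    ... | x , ex , x1 , xn , cx , colx with B h x in e
    ...   | false = x , x1 , ≤-reflexive (sym colx) , ex , e
    ...   | true = let (y , y1 , yx , ey , ny) = countTo-<⇒∃∉ (B h) (B (suc h)) nest x x-not-new in y , y1 , ≤-trans yx (≤-reflexive (sym colx)) , ey , ny
      where
      nest = B-nested h hr
      x-not-new : countTo (B h) x < countTo (B (suc h)) x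
      x-not-new = subst (countTo (B h) x <_) (sym cx)
        (≤∧≢⇒< (subst (countTo (B h) x ≤_) cx (countTo-⊆ _ _ nest x))
               (λ ce → ne (trans (cong (column n (B h)) (sym ce)) (trans (column-countTo n (B h) x e x1 xn) (sym colx)))))

    column-jump : ∀ h → 1 ≤ h → h ≤ r′ → ∀ i → 1 ≤ i → i ≤ Q h → column n (B h) i ≢ column n (B (suc h)) i →
                  column n (B (suc h)) (suc (Q h)) + i ≡ column n (B (suc h)) i + suc (Q h)
    column-jump h a hr i i1 iQ ne
      with column-spec n (B (suc h)) i i1 (subst (i ≤_) (sym (B-count (suc h) (s≤s hr))) (≤-trans iQ (<⇒≤ (Q-< h hr))))
         | new-below-column h hr i i1 iQ ne
    ... | x , _ , _ , _ , cx , colx | y , y1 , y≤col , ey , ny =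
      begin
        column n (B (suc h)) (suc (Q h)) + i ≡⟨ cong (λ j → column n (B (suc h)) j + i) (sym (trans (cong (_+ d) cx) i+d)) ⟩
        column n (B (suc h)) (countTo (B (suc h)) x + d) + i ≡⟨ cong (_+ i) (column-consecutive h a hr y m ey ny em x d yx x+d≤m) ⟩
        x + d + i ≡⟨ +-assoc x d i ⟩
        x + (d + i) ≡⟨ cong (x +_) (trans (+-comm d i) i+d) ⟩
        x + suc (Q h) ≡⟨ cong (_+ suc (Q h)) (sym colx) ⟩
        column n (B (suc h)) i + suc (Q h) ∎
      where
      open ≡-Reasoning
      hs : h ≤ suc r′
      hs = ≤-trans hr (n≤1+n r′)
      nest = B-nested h hr
      yx : y ≤ x
      yx = subst (y ≤_) colx y≤col
      mspec = column-spec n (B h) (Q h) (Q-pos h a hs) (≤-reflexive (sym (B-count h hs)))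
      m = proj₁ mspec
      em = proj₁ (proj₂ mspec)
      cm = proj₁ (proj₂ (proj₂ (proj₂ (proj₂ mspec))))
      x≤m : x ≤ m
      x≤m = ≮⇒≥ (λ m<x → <⇒≱ (≤-<-trans iQ (≤-trans (s≤s (subst (_≤ countTo (B h) x) cm (countTo-mono (B h) (<⇒≤ m<x))))
                               (subst (suc (countTo (B h) x) ≤_) cx (countTo-⊂ (B h) (B (suc h)) nest y x ey ny y1 yx)))) ≤-refl)
      d = suc (Q h) ∸ i
      i+d : i + d ≡ suc (Q h)
      i+d = m+[n∸m]≡n (≤-trans iQ (n≤1+n _))
      countTo-m : countTo (B (suc h)) m ≡ i + (m ∸ x)
      countTo-m = trans (subst (λ w → countTo (B (suc h)) w ≡ countTo (B (suc h)) x + (m ∸ x)) (m+[n∸m]≡n x≤m)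
                               (proj₂ (countTo-consecutive h a hr y m ey ny em x (m ∸ x) yx (≤-reflexive (m+[n∸m]≡n x≤m)))))
                        (cong (_+ (m ∸ x)) cx)
      Qh<countTo-m : suc (Q h) ≤ countTo (B (suc h)) m
      Qh<countTo-m = subst (λ w → suc w ≤ countTo (B (suc h)) m) cm (countTo-⊂ (B h) (B (suc h)) nest y m ey ny y1 (≤-trans yx x≤m))
      x+d≤m : x + d ≤ m
      x+d≤m = subst (x + d ≤_) (m+[n∸m]≡n x≤m)
                (+-monoʳ-≤ x (+-cancelˡ-≤ i d (m ∸ x) (subst (_≤ i + (m ∸ x)) (sym i+d) (subst (suc (Q h) ≤_) countTo-m Qh<countTo-m))))

    -- Row i of the column of B h is reached diagonally from row k of the column of B (carrel′ k),
    -- whose entry in row k is fixed by Ψ; this is what bounds every tableau fitting Ψ.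
    column-witness : ∀ h → 1 ≤ h → h ≤ suc r′ → ∀ i → 1 ≤ i → i ≤ Q h →
                     ∃[ k ] (i ≤ k × k ≤ Q h × column n (B (carrel′ k)) k + i ≤ column n (B h) i + k)
    column-witness (suc h) _ hs i i1 iQ with Q h <? i
    ... | yes lt = i , ≤-refl , iQ , ≤-reflexive (cong (λ c → column n (B c) i + i) (carrel′-unique (suc h) i (s≤s z≤n) hs lt iQ))
    ... | no nlt with column n (B h) i ≟ column n (B (suc h)) i
    ...   | yes eq = let (k , ik , kQ , ineq) = column-witness h h≥1 (≤-trans hr (n≤1+n r′)) i i1 i≤Qh in
                     k , ik , ≤-trans kQ (<⇒≤ (Q-< h hr)) , subst (λ z → column n (B (carrel′ k)) k + i ≤ z + k) eq ineq
      where
      i≤Qh = ≮⇒≥ nlt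
      hr = s≤s⁻¹ hs
      h≥1 : 1 ≤ h
      h≥1 = Q-pos⁻ h i1 i≤Qh
    ...   | no ne = suc (Q h) , ≤-trans i≤Qh (n≤1+n _) , Q-< h hr ,
                    ≤-reflexive (trans (cong (λ c → column n (B c) (suc (Q h)) + i) (carrel′-unique (suc h) (suc (Q h)) (s≤s z≤n) hs ≤-refl (Q-< h hr)))
                                       (column-jump h h≥1 hr i i1 i≤Qh ne))
      where
      i≤Qh = ≮⇒≥ nlt
      hr = s≤s⁻¹ hs
      h≥1 : 1 ≤ h
      h≥1 = Q-pos⁻ h i1 i≤Qh

  module AvoidingPerm (π : ℕ → ℕ) (avoiding : Avoids312 n lam π) where
    open PsiOf π (proj₁ avoiding)
    open RChain Bπ chπ
    open ChainGaps Bπ chπ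
    cg : ChainGap Bπ
    cg = ¬312⇒ChainGap (proj₂ avoiding)
    open GaplessChain Bπ chπ cg
    open Portrayal Bπ chπ

    Psi-spec : ∀ i → 1 ≤ i → i ≤ n → i ≤ Psi n lam π i × Psi n lam π i ≤ n × countTo (Bπ (carrel′ i)) (Psi n lam π i) ≡ i
    Psi-spec i a b with carrel′-spec i a b
    ... | (c1 , c2 , c3 , c4) with column-spec n (Bπ (carrel′ i)) i a (subst (i ≤_) (sym (B-count (carrel′ i) c2)) c4)
    ...   | x , ex , x1 , xn , cx , colx = subst (λ w → i ≤ w × w ≤ n × countTo (Bπ (carrel′ i)) w ≡ i) (sym (trans (Psi≡column i a b) colx))
                                              (subst (_≤ x) cx (countTo≤ _ x) , xn , cx)

    keyOf-Fits : Fits n lam (Psi n lam π) (keyOf n lam π)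
    keyOf-Fits i a b l = trans (portrayal-column (lam i) l (lam-antitone 1 i ≤-refl a b) i)
                      (trans (cong (λ h → column n (Bπ h) i) (trans (cong carrel′ (ζ-lam≡Q-carrel′ i a b l)) (carrel′-Q (carrel′ i) c1 c2)))
                        (sym (Psi≡column i a b)))
      where
      c1 = proj₁ (carrel′-spec i a b)
      c2 = proj₁ (proj₂ (carrel′-spec i a b))

    -- T j i + k ≤ T j k + i ≤ T (lam k) k + i = Ψ k + i, and the witness turns the right side into the key entry plus k.
    keyOf-maximal : ∀ T → InT n lam T → Fits n lam (Psi n lam π) T → TabLe n lam T (keyOf n lam π)
    keyOf-maximal T tT fT j i (a , b , c , d) = subst (T j i ≤_) (sym (portrayal-column j a b i)) (+-cancelʳ-≤ k (T j i) (column n (Bπ h) i) chain)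
      where
      hs = carrel′-ζ-spec j a b
      h = carrel′ (ζ j)
      wt = column-witness h (proj₁ hs) (proj₁ (proj₂ hs)) i c (subst (i ≤_) (sym (proj₂ (proj₂ hs))) d)
      k = proj₁ wt
      ik = proj₁ (proj₂ wt)
      kz : k ≤ ζ j
      kz = subst (k ≤_) (proj₂ (proj₂ hs)) (proj₁ (proj₂ (proj₂ wt)))
      ineq = proj₂ (proj₂ (proj₂ wt))
      k1 : 1 ≤ k
      k1 = ≤-trans c ik
      kn : k ≤ n
      kn = ≤-trans kz (ζ≤n j)
      jl : j ≤ lam k
      jl = ≤ζ⇒≤lam j k k1 kn kz
      lk1 : lam k ≤ lam 1
      lk1 = lam-antitone 1 k ≤-refl k1 kn
      chain : T j i + k ≤ column n (Bπ h) i + k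
      chain = ≤-trans (InT-column-gap T tT j a b i k c ik kz)
                (≤-trans (+-monoˡ-≤ i (≤-trans (InT-row-mono T tT j (lam k) k a jl lk1 k1 (≤lam⇒≤ζ (lam k) k k1 kn ≤-refl))
                                                (≤-reflexive (trans (fT k k1 kn (≤-trans a jl)) (Psi≡column k k1 kn)))))
                  ineq)

    keyOf-IsM : IsM n lam (Psi n lam π) (keyOf n lam π)
    keyOf-IsM = (portrayal-InT , keyOf-Fits) , keyOf-maximal

    ψ : ℕ → ℕ
    ψ = Psi n lam π

    Psi-UI : UI n lam ψ
    Psi-UI = (λ i a b → let (p1 , p2 , _) = Psi-spec i a b in p1 , p2) , increasing
      where
      increasing : IncOnCarrels n lam ψ
      increasing h a b i c d = countTo-<⇒< (Bπ h) (subst₂ _<_ (sym e1) (sym e2) ≤-refl)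
        where
        in' : suc i ≤ n
        in' = ≤-trans d (Q≤n h b)
        e1 : countTo (Bπ h) (ψ i) ≡ i
        e1 = subst (λ z → countTo (Bπ z) (ψ i) ≡ i) (carrel′-unique h i a b c (≤-trans (n≤1+n i) d))
                   (proj₂ (proj₂ (Psi-spec i (≤-trans (s≤s z≤n) c) (≤-trans (n≤1+n i) in'))))
        e2 : countTo (Bπ h) (ψ (suc i)) ≡ suc i
        e2 = subst (λ z → countTo (Bπ z) (ψ (suc i)) ≡ suc i) (carrel′-unique h (suc i) a b (<-trans c (n<1+n i)) d)
                   (proj₂ (proj₂ (Psi-spec (suc i) (s≤s z≤n) in')))

    Psi-consecutive : ∀ h → 1 ≤ h → h ≤ r′ → ψ (suc (Q h)) < ψ (Q h) → ∀ t → t ≤ ψ (Q h) ∸ ψ (suc (Q h)) →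
                      Q h + suc t ≤ Q (suc h) × ψ (Q h + suc t) ≡ ψ (suc (Q h)) + t
    Psi-consecutive h a hr x<m t t≤ = bound , value
      where
      hs : h ≤ suc r′
      hs = ≤-trans hr (n≤1+n r′)
      m = ψ (Q h)
      x = ψ (suc (Q h))
      mspec = column-spec n (Bπ h) (Q h) (Q-pos h a hs) (≤-reflexive (sym (B-count h hs)))
      em : Bπ h m ≡ true
      em = subst (λ w → Bπ h w ≡ true)
                 (sym (trans (Psi≡column (Q h) (Q-pos h a hs) (Q≤n h hs))
                             (trans (cong (λ c → column n (Bπ c) (Q h)) (carrel′-Q h a hs)) (proj₂ (proj₂ (proj₂ (proj₂ (proj₂ mspec))))))))
                 (proj₁ (proj₂ mspec))
      xspec = Psi-spec (suc (Q h)) (s≤s z≤n) (≤-trans (Q-< h hr) (Q≤n (suc h) (s≤s hr)))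
      cx : countTo (Bπ (suc h)) x ≡ suc (Q h)
      cx = subst (λ c → countTo (Bπ c) x ≡ suc (Q h)) (carrel′-unique (suc h) (suc (Q h)) (s≤s z≤n) (s≤s hr) ≤-refl (Q-< h hr))
                 (proj₂ (proj₂ xspec))
      new≤x = countTo-<⇒∃∉ (Bπ h) (Bπ (suc h)) (B-nested h hr) x
                (subst (countTo (Bπ h) x <_) (sym cx) (s≤s (subst (countTo (Bπ h) x ≤_) (B-count h hs) (countTo-mono (Bπ h) (proj₁ (proj₂ xspec))))))
      y = proj₁ new≤x
      yx = proj₁ (proj₂ (proj₂ new≤x))
      ey = proj₁ (proj₂ (proj₂ (proj₂ new≤x)))
      ny = proj₂ (proj₂ (proj₂ (proj₂ new≤x)))
      x+t≤m : x + t ≤ m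
      x+t≤m = subst (x + t ≤_) (m+[n∸m]≡n (<⇒≤ x<m)) (+-monoʳ-≤ x t≤)
      index : countTo (Bπ (suc h)) x + t ≡ Q h + suc t
      index = trans (cong (_+ t) cx) (sym (+-suc (Q h) t))
      bound : Q h + suc t ≤ Q (suc h)
      bound = subst₂ _≤_ (trans (proj₂ (countTo-consecutive h a hr y m ey ny em x t yx x+t≤m)) index) (B-count (suc h) (s≤s hr))
                         (countTo-mono (Bπ (suc h)) (≤-trans x+t≤m (proj₂ (B-bounded h hs m em))))
      value : ψ (Q h + suc t) ≡ x + t
      value = trans (Psi≡column (Q h + suc t) (≤-trans (s≤s z≤n) (m≤n+m _ (Q h))) (≤-trans bound (Q≤n (suc h) (s≤s hr))))
                    (trans (cong (λ c → column n (Bπ c) (Q h + suc t))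
                                 (carrel′-unique (suc h) (Q h + suc t) (s≤s z≤n) (s≤s hr) (m<m+n (Q h) (s≤s z≤n)) bound))
                           (trans (cong (column n (Bπ (suc h))) (sym index))
                                  (column-consecutive h a hr y m ey ny em x t yx x+t≤m)))

    Psi-UG : UG n lam ψ
    Psi-UG = Psi-UI , gapless
      where
      gapless : ∀ h → 1 ≤ h → h ≤ r′ → ψ (suc (Q h)) < ψ (Q h) →
                (ψ (Q h) ∸ ψ (suc (Q h)) + 1) ≤ Q (suc h) ∸ Q (suc h ∸ 1) ×
                (∀ t → 1 ≤ t → t ≤ ψ (Q h) ∸ ψ (suc (Q h)) + 1 → ψ (Q h + t) ≡ (ψ (Q h) + t) ∸ (ψ (Q h) ∸ ψ (suc (Q h)) + 1))
      gapless h a hr x<m = s≤p , shape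
        where
        m = ψ (Q h)
        x = ψ (suc (Q h))
        s≤p : m ∸ x + 1 ≤ Q (suc h) ∸ Q h
        s≤p = subst (_≤ Q (suc h) ∸ Q h) (trans (m+n∸m≡n (Q h) (suc (m ∸ x))) (+-comm 1 (m ∸ x)))
                    (∸-monoˡ-≤ (Q h) (proj₁ (Psi-consecutive h a hr x<m (m ∸ x) ≤-refl)))
        shape : ∀ t → 1 ≤ t → t ≤ m ∸ x + 1 → ψ (Q h + t) ≡ (m + t) ∸ (m ∸ x + 1)
        shape (suc t) _ t≤ = trans (proj₂ (Psi-consecutive h a hr x<m t (s≤s⁻¹ (subst (suc t ≤_) (+-comm (m ∸ x) 1) t≤))))
                                   (sym (+∸-shift m x t (<⇒≤ x<m)))

module GaplessTuples (n : ℕ) (lam : ℕ → ℕ) (n≥1 : 1 ≤ n) (part : IsPartition n lam) where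

  open Shape n lam n≥1 part
  open Chains n lam n≥1 part
  open Keys n lam n≥1 part
  open Maximal n lam n≥1 part

  module GaplessTuple (γ : ℕ → ℕ) (ug : UG n lam γ) where
    γ-bounded : ∀ i → 1 ≤ i → i ≤ n → i ≤ γ i × γ i ≤ n
    γ-bounded = proj₁ (proj₁ ug)

    γ-increasing : IncOnCarrels n lam γ
    γ-increasing = proj₂ (proj₁ ug)

    -- B (h+1) is built from B h so that its column has γ on the carrel (Q h, Q (h+1)]:
    -- below x = γ (Q h + 1) it keeps B h and adds the largest non-members of B h until it has
    -- Q h elements there; from x on it consists of the values of γ on that carrel.
    carrelValue : ℕ → ℕ → ℕ
    carrelValue h k = γ (Q h + k)

    carrelSize : ℕ → ℕ
    carrelSize h = Q (suc h) ∸ Q h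

    carrelSet : ℕ → SubSet
    carrelSet h = firstSet (carrelValue h) (carrelSize h)

    firstValue : ℕ → ℕ
    firstValue h = γ (suc (Q h))

    complement : SubSet → SubSet
    complement Bh z = not (Bh z)

    skipCount : ℕ → SubSet → ℕ
    skipCount h Bh = countTo (complement Bh) (firstValue h ∸ 1) ∸ (Q h ∸ countTo Bh (firstValue h ∸ 1))

    fillers : ℕ → SubSet → SubSet
    fillers h Bh z = complement Bh z ∧ (skipCount h Bh <ᵇ countTo (complement Bh) z)

    lowerPart : ℕ → SubSet → SubSet
    lowerPart h Bh z = (z <ᵇ firstValue h) ∧ (Bh z ∨ fillers h Bh z)

    nextSet : ℕ → SubSet → SubSet
    nextSet h Bh z = lowerPart h Bh z ∨ carrelSet h z

    build : ℕ → SubSet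
    build zero = λ _ → false
    build (suc h) = nextSet h (build h)

    module BuildStep (h : ℕ) (hr : h ≤ r′) (Bh : SubSet)
       (Bh-bounded : ∀ z → Bh z ≡ true → 1 ≤ z × z ≤ n)
       (Bh-size : countTo Bh n ≡ Q h)
       (Bh-below : ∀ z → Bh z ≡ true → 1 ≤ h × z ≤ γ (Q h)) where

      B′ = nextSet h Bh
      carrelSize-pos : 1 ≤ carrelSize h
      carrelSize-pos = m<n⇒0<n∸m (Q-< h hr)
      Q+carrelSize : Q h + carrelSize h ≡ Q (suc h)
      Q+carrelSize = m+[n∸m]≡n (<⇒≤ (Q-< h hr))
      carrel-index : ∀ k → 1 ≤ k → k ≤ carrelSize h → 1 ≤ Q h + k × Q h + k ≤ n × Q h < Q h + k × Q h + k ≤ Q (suc h)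
      carrel-index k a b = ≤-trans a (m≤n+m k (Q h)) , ≤-trans le (Q≤n (suc h) (s≤s hr)) , subst (_≤ Q h + k) (+-comm (Q h) 1) (+-monoʳ-≤ (Q h) a) , le
        where
        le : Q h + k ≤ Q (suc h)
        le = subst (Q h + k ≤_) Q+carrelSize (+-monoʳ-≤ (Q h) b)
      carrelValue-strict : StrictOn (carrelValue h) (carrelSize h)
      carrelValue-strict k a b = subst (γ (Q h + k) <_) (cong γ (sym (+-suc (Q h) k)))
                     (γ-increasing (suc h) (s≤s z≤n) (s≤s hr) (Q h + k) (proj₁ (proj₂ (proj₂ (carrel-index k a (≤-trans (n≤1+n k) b)))))
                       (subst (_≤ Q (suc h)) (+-suc (Q h) k) (proj₂ (proj₂ (proj₂ (carrel-index (suc k) (s≤s z≤n) b))))))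
      carrelValue-bounded : ∀ k → 1 ≤ k → k ≤ carrelSize h → 1 ≤ carrelValue h k × carrelValue h k ≤ n
      carrelValue-bounded k a b = let (i1 , i2 , _ , _) = carrel-index k a b in ≤-trans i1 (proj₁ (γ-bounded _ i1 i2)) , proj₂ (γ-bounded _ i1 i2)
      x = firstValue h
      carrelValue-1 : carrelValue h 1 ≡ x
      carrelValue-1 = cong γ (+-comm (Q h) 1)
      firstValue-≥ : suc (Q h) ≤ x
      firstValue-≥ = proj₁ (γ-bounded (suc (Q h)) (s≤s z≤n) (≤-trans (Q-< h hr) (Q≤n (suc h) (s≤s hr))))
      x1 : 1 ≤ x
      x1 = ≤-trans (s≤s z≤n) firstValue-≥
      firstValue-≤ : ∀ k → 1 ≤ k → k ≤ carrelSize h → x ≤ carrelValue h k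
      firstValue-≤ k a b with m≤n⇒m<n∨m≡n a
      ... | inj₂ refl = ≤-reflexive (sym carrelValue-1)
      ... | inj₁ t = subst (_≤ carrelValue h k) carrelValue-1 (<⇒≤ (StrictOn-< (carrelValue h) (carrelSize h) carrelValue-strict 1 k ≤-refl t b))
      carrelValue-≤-last : ∀ k → 1 ≤ k → k ≤ carrelSize h → carrelValue h k ≤ γ (Q (suc h))
      carrelValue-≤-last k a b with m≤n⇒m<n∨m≡n b
      ... | inj₂ refl = ≤-reflexive (cong γ Q+carrelSize)
      ... | inj₁ t = subst (carrelValue h k ≤_) (cong γ Q+carrelSize) (<⇒≤ (StrictOn-< (carrelValue h) (carrelSize h) carrelValue-strict k (carrelSize h) a t ≤-refl))
      carrelSet-∈⁻ : ∀ z → carrelSet h z ≡ true → Σ ℕ λ k → 1 ≤ k × k ≤ carrelSize h × carrelValue h k ≡ z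
      carrelSet-∈⁻ z e = firstSet-∈⁻ (carrelValue h) (carrelSize h) z e
      carrelSet-size : countTo (carrelSet h) n ≡ carrelSize h
      carrelSet-size = countTo-firstSet n (carrelValue h) (carrelSize h) carrelValue-bounded (StrictOn-injective (carrelValue h) (carrelSize h) carrelValue-strict)
      interval⊆carrelSet : 1 ≤ h → ∀ z → x ≤ z → z ≤ γ (Q h) → carrelSet h z ≡ true
      interval⊆carrelSet h1 z xz zm with x <? γ (Q h)
      ... | no nlt = subst (λ w → carrelSet h w ≡ true) (trans carrelValue-1 zx) (firstSet-∈ (carrelValue h) (carrelSize h) 1 ≤-refl carrelSize-pos)
        where
        zx : x ≡ z
        zx = ≤-antisym xz (≤-trans zm (≮⇒≥ nlt))
      ... | yes lt = subst (λ w → carrelSet h w ≡ true) vt (firstSet-∈ (carrelValue h) (carrelSize h) t (s≤s z≤n) (≤-trans ts sle))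
        where
        m = γ (Q h)
        ug' = proj₂ ug h h1 hr lt
        sle : m ∸ x + 1 ≤ carrelSize h
        sle = proj₁ ug'
        t = suc (z ∸ x)
        ts : t ≤ m ∸ x + 1
        ts = subst (t ≤_) (+-comm 1 (m ∸ x)) (s≤s (∸-monoˡ-≤ x zm))
        vt : carrelValue h t ≡ z
        vt = trans (proj₂ ug' t (s≤s z≤n) ts) (trans (+∸-shift m x (z ∸ x) (<⇒≤ lt)) (m+[n∸m]≡n xz))

      c = countTo Bh (x ∸ 1)
      NB = complement Bh
      need = Q h ∸ c
      K = skipCount h Bh
      cle : c ≤ Q h
      cle = subst (c ≤_) Bh-size (countTo-mono Bh (≤-trans (m∸n≤m x 1) (proj₂ (γ-bounded (suc (Q h)) (s≤s z≤n) (≤-trans (Q-< h hr) (Q≤n (suc h) (s≤s hr)))))))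
      cNB : countTo NB (x ∸ 1) ≡ (x ∸ 1) ∸ c
      cNB = trans (sym (m+n∸m≡n c (countTo NB (x ∸ 1)))) (cong (_∸ c) (countTo-complement Bh (x ∸ 1)))
      needle : need ≤ countTo NB (x ∸ 1)
      needle = subst (need ≤_) (sym cNB) (∸-monoˡ-≤ c (<⇒≤∸1 firstValue-≥))
      cF : countTo (fillers h Bh) (x ∸ 1) ≡ need
      cF = trans (countTo-dropFirst NB K (x ∸ 1)) (m∸[m∸n]≡n needle)
      djBF : ∀ z → Bh z ≡ true → fillers h Bh z ≡ false
      djBF z e = ∧≡falseˡ _ (cong not e)
      cBF : countTo (λ z → Bh z ∨ fillers h Bh z) (x ∸ 1) ≡ Q h
      cBF = trans (countTo-∪ Bh (fillers h Bh) djBF (x ∸ 1)) (trans (cong (c +_) cF) (m+[n∸m]≡n cle))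
      lower = lowerPart h Bh
      lower-< : ∀ z → lower z ≡ true → z < x
      lower-< z e = <ᵇ≡true⇒< (proj₁ (∧≡true⇒ {z <ᵇ x} e))
      cL : countTo lower (x ∸ 1) ≡ Q h
      cL = trans (countTo-ext lower _ (x ∸ 1) (λ z a b → lem z (≤∸1⇒< b x1))) cBF
        where
        lem : ∀ z → z < x → lower z ≡ (Bh z ∨ fillers h Bh z)
        lem z p rewrite <⇒<ᵇ≡true p = refl
      countTo-lower : ∀ N → x ∸ 1 ≤ N → countTo lower N ≡ Q h
      countTo-lower N p = trans (countTo-const lower (x ∸ 1) N p (λ z a b → ≢true⇒≡false (λ e → <⇒≱ (lower-< z e) (∸1<⇒ x z a)))) cL
      djLG : ∀ z → lower z ≡ true → carrelSet h z ≡ false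
      djLG z e = ≢true⇒≡false (λ g → let (k , a , b , vk) = carrelSet-∈⁻ z g in <⇒≱ (lower-< z e) (subst (x ≤_) vk (firstValue-≤ k a b)))
      countTo-next : ∀ N → x ∸ 1 ≤ N → countTo B′ N ≡ Q h + countTo (carrelSet h) N
      countTo-next N p = trans (countTo-∪ lower (carrelSet h) djLG N) (cong (_+ countTo (carrelSet h) N) (countTo-lower N p))

      next-size : countTo B′ n ≡ Q (suc h)
      next-size = trans (countTo-next n (≤-trans (m∸n≤m x 1) (subst (_≤ n) carrelValue-1 (proj₂ (carrelValue-bounded 1 ≤-refl carrelSize-pos)))))
                        (trans (cong (Q h +_) carrelSet-size) Q+carrelSize)

      fillers-pos : ∀ z → fillers h Bh z ≡ true → 1 ≤ z
      fillers-pos zero f = ⊥-elim (true≢false (trans (sym (proj₂ (∧≡true⇒ {NB 0} f))) (≥⇒<ᵇ≡false {K} {0} z≤n)))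
      fillers-pos (suc _) f = s≤s z≤n

      next-bounded : ∀ z → B′ z ≡ true → 1 ≤ z × z ≤ n
      next-bounded z e with ∨≡true⇒ {lower z} e
      ... | inj₂ g = let (k , a , b , vk) = carrelSet-∈⁻ z g in subst (λ w → 1 ≤ w × w ≤ n) vk (carrelValue-bounded k a b)
      ... | inj₁ l = z1 , ≤-trans (<⇒≤ (lower-< z l)) (subst (_≤ n) carrelValue-1 (proj₂ (carrelValue-bounded 1 ≤-refl carrelSize-pos)))
        where
        z1 : 1 ≤ z
        z1 with ∨≡true⇒ {Bh z} (proj₂ (∧≡true⇒ {z <ᵇ x} l))
        ... | inj₁ b = proj₁ (Bh-bounded z b)
        ... | inj₂ f = fillers-pos z f

      next-below : ∀ z → B′ z ≡ true → 1 ≤ suc h × z ≤ γ (Q (suc h))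
      next-below z e with ∨≡true⇒ {lower z} e
      ... | inj₂ g = let (k , a , b , vk) = carrelSet-∈⁻ z g in s≤s z≤n , subst (_≤ γ (Q (suc h))) vk (carrelValue-≤-last k a b)
      ... | inj₁ l = s≤s z≤n , ≤-trans (<⇒≤ (lower-< z l)) (subst (_≤ γ (Q (suc h))) carrelValue-1 (carrelValue-≤-last 1 ≤-refl carrelSize-pos))

      next-⊇ : ∀ z → Bh z ≡ true → B′ z ≡ true
      next-⊇ z e with z <? x
      ... | yes lt = ∨≡trueˡ _ (∧≡true (<⇒<ᵇ≡true lt) (∨≡trueˡ _ e))
      ... | no nlt = ∨≡trueʳ (lower z) (interval⊆carrelSet (proj₁ (Bh-below z e)) z (≮⇒≥ nlt) (proj₂ (Bh-below z e)))

      column-next : ∀ t → 1 ≤ t → t ≤ carrelSize h → column n B′ (Q h + t) ≡ carrelValue h t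
      column-next t a b = subst (λ j → column n B′ j ≡ carrelValue h t) cw
                                (column-countTo n B′ (carrelValue h t) ew (proj₁ (carrelValue-bounded t a b)) (proj₂ (carrelValue-bounded t a b)))
        where
        ew : B′ (carrelValue h t) ≡ true
        ew = ∨≡trueʳ (lower (carrelValue h t)) (firstSet-∈ (carrelValue h) (carrelSize h) t a b)
        cw : countTo B′ (carrelValue h t) ≡ Q h + t
        cw = trans (countTo-next (carrelValue h t) (≤-trans (m∸n≤m x 1) (firstValue-≤ t a b)))
                   (cong (Q h +_) (countTo-firstSet-strict (carrelValue h) (carrelSize h) carrelValue-strict
                                                           (λ k c d → proj₁ (carrelValue-bounded k c d)) t a b))

      next-ChainGap : ∀ x' y z → Bh x' ≡ true → B′ y ≡ true → Bh y ≡ false → y ≤ z → z ≤ x' → B′ z ≡ true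
      next-ChainGap x' y z ex' ey ny yz zx' with z <? x
      ... | no nlt = ∨≡trueʳ (lower z) (interval⊆carrelSet (proj₁ (Bh-below x' ex')) z (≮⇒≥ nlt) (≤-trans zx' (proj₂ (Bh-below x' ex'))))
      ... | yes lt with ∨≡true⇒ {lower y} ey
      ...   | inj₂ g = ⊥-elim (<⇒≱ (≤-<-trans yz lt) (let (k , a , b , vk) = carrelSet-∈⁻ y g in subst (x ≤_) vk (firstValue-≤ k a b)))
      ...   | inj₁ l with ∨≡true⇒ {Bh y} (proj₂ (∧≡true⇒ {y <ᵇ x} l))
      ...     | inj₁ b = ⊥-elim (true≢false (trans (sym b) ny))
      ...     | inj₂ fy with Bh z in ez
      ...       | true = ∨≡trueˡ _ (∧≡true (<⇒<ᵇ≡true lt) refl)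
      ...       | false = ∨≡trueˡ _ (∧≡true (<⇒<ᵇ≡true lt) (<⇒<ᵇ≡true (<-≤-trans (<ᵇ≡true⇒< (proj₂ (∧≡true⇒ {NB y} fy))) (countTo-mono NB yz))))

    record BuildInvariant (h : ℕ) : Set where
      field
        bounded : ∀ z → build h z ≡ true → 1 ≤ z × z ≤ n
        size : countTo (build h) n ≡ Q h
        below : ∀ z → build h z ≡ true → 1 ≤ h × z ≤ γ (Q h)
        column≡γ : ∀ i → Q (h ∸ 1) < i → i ≤ Q h → column n (build h) i ≡ γ i

    build-invariant : ∀ h → h ≤ suc r′ → BuildInvariant h
    build-invariant zero _ = record
      { bounded = λ z () ; size = countTo-∅ _ n (λ _ → refl) ; below = λ z () ; column≡γ = λ i a b → ⊥-elim (<⇒≱ a b) }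
    build-invariant (suc h) p = record
      { bounded = next-bounded ; size = next-size ; below = next-below ; column≡γ = column≡γ }
      where
      open BuildInvariant (build-invariant h (≤-trans (n≤1+n h) p)) using (bounded; size; below)
      open BuildStep h (s≤s⁻¹ p) (build h) bounded size below
      column≡γ : ∀ i → Q h < i → i ≤ Q (suc h) → column n (build (suc h)) i ≡ γ i
      column≡γ i a b = trans (cong (column n (build (suc h))) (sym Qh+t≡i))
                             (trans (column-next (i ∸ Q h) (m<n⇒0<n∸m a) (∸-monoˡ-≤ (Q h) b)) (cong γ Qh+t≡i))
        where
        Qh+t≡i : Q h + (i ∸ Q h) ≡ i
        Qh+t≡i = m+[n∸m]≡n (<⇒≤ a)

    module Next (h : ℕ) (hr : h ≤ r′) where
      open BuildInvariant (build-invariant h (≤-trans hr (n≤1+n r′))) using (bounded; size; below)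
      open BuildStep h hr (build h) bounded size below public

    build-RChain : IsRChain n lam build
    build-RChain = (λ x → refl) , top , (λ h p → BuildInvariant.bounded (build-invariant h p)) ,
                   (λ h p → Next.next-⊇ h p) , (λ h p → BuildInvariant.size (build-invariant h p))
      where
      open BuildInvariant (build-invariant (suc r′) ≤-refl)
      top : ∀ x → build (suc r′) x ≡ fullSet n x
      top = ⊆∧countTo≡⇒≡ n (build (suc r′)) (fullSet n) (λ z e → fullSet-∈ n z (proj₁ (bounded z e)) (proj₂ (bounded z e)))
                         (trans size (trans Q-top (sym (countTo-fullSet n)))) (fullSet-∈⁻ n)

    build-ChainGap : ChainGap build
    build-ChainGap h a hb = Next.next-ChainGap h (≤-trans hb (m∸n≤m r′ 1))

  module PermOfGapless (γ : ℕ → ℕ) (ug : UG n lam γ) where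
    open GaplessTuple γ ug
    open RChain build build-RChain using (πOf; πOf-SnR; chainOf-πOf)

    π : ℕ → ℕ
    π = πOf

    avoiding : Avoids312 n lam π
    avoiding = ChainGap⇒avoiding-πOf build build-RChain build-ChainGap

    Psi≡γ : ∀ i → 1 ≤ i → i ≤ n → Psi n lam π i ≡ γ i
    Psi≡γ i a b with carrel′-spec i a b
    ... | _ , c2 , c3 , c4 = trans (PsiOf.Psi≡column π πOf-SnR i a b)
                               (trans (column-ext n _ _ (λ x _ _ → chainOf-πOf (carrel′ i) c2 x) i)
                                      (BuildInvariant.column≡γ (build-invariant (carrel′ i) c2) i c3 c4))

module Main (n : ℕ) (lam : ℕ → ℕ) (n≥1 : 1 ≤ n) (part : IsPartition n lam) where

  open Shape n lam n≥1 part
  open Chains n lam n≥1 part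
  open Keys n lam n≥1 part
  open Maximal n lam n≥1 part
  open GaplessTuples n lam n≥1 part

  IsM-cong : ∀ α α' M → (∀ i → 1 ≤ i → i ≤ n → α i ≡ α' i) → IsM n lam α M → IsM n lam α' M
  IsM-cong α α' M eq ((tM , fM) , mx) =
    (tM , λ i a b l → trans (fM i a b l) (eq i a b)) , λ T tT fT → mx T tT (λ i a b l → trans (fT i a b l) (sym (eq i a b)))

  -- Such an i lies in the last carrel (Q r, n], where γ increases strictly and stays ≤ n.
  UI-fixed-beyond-parts : ∀ γ → UI n lam γ → ∀ i → 1 ≤ i → i ≤ n → lam i ≡ 0 → γ i ≡ i
  UI-fixed-beyond-parts γ (bounded , increasing) i a b l0 = ≤-antisym gi (proj₁ (bounded i a b))
    where
    crr : countTo inR (i ∸ 1) ≡ r′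
    crr = sym (countTo-const inR (i ∸ 1) (n ∸ 1) (∸-monoˡ-≤ 1 b) (λ x p q → ≢true⇒≡false (λ e → lem x p e)))
      where
      lem : ∀ x → i ∸ 1 < x → inR x ≡ true → ⊥
      lem x p e = let (j , j1 , j2 , zj) = inR⇒column x e in <⇒≱ (subst (_< i) zj (lam<⇒ζ< j i a b (subst (_< j) (sym l0) j1))) (∸1<⇒ i x p)
    Qlt : Q r′ < i
    Qlt = subst (λ c → Q (c ∸ 1) < i) (trans (carrel′≡ i a b) (cong suc crr)) (proj₁ (proj₂ (proj₂ (carrel′-spec i a b))))
    down : ∀ d k → k + d ≡ n → Q r′ < k → γ k + d ≤ n
    down zero k e p = subst (_≤ n) (sym (+-identityʳ (γ k))) (proj₂ (bounded k (≤-trans (s≤s z≤n) p) (subst (k ≤_) e (m≤m+n k 0))))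
    down (suc d) k e p = ≤-trans (subst (_≤ γ (suc k) + d) (sym (+-suc (γ k) d)) (+-monoˡ-≤ d inc)) (down d (suc k) (trans (sym (+-suc k d)) e) (<-trans p (n<1+n k)))
      where
      inc : γ k < γ (suc k)
      inc = increasing (suc r′) (s≤s z≤n) ≤-refl k p (subst (suc k ≤_) (trans e (sym Q-top)) (subst (suc k ≤_) (sym (+-suc k d)) (m≤m+n (suc k) d)))
    gi : γ i ≤ i
    gi = +-cancelʳ-≤ (n ∸ i) (γ i) i (subst (γ i + (n ∸ i) ≤_) (sym (m+[n∸m]≡n b)) (down (n ∸ i) i (m+[n∸m]≡n b) Qlt))

  RChain-≤n : ∀ B → IsRChain n lam B → ∀ h → 1 ≤ h → h ≤ r′ → ∀ x → B h x ≡ true → x ≤ n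
  RChain-≤n B ch h a b x e = proj₂ (RChain.B-bounded B ch h (≤-trans b (n≤1+n r′)) x e)

  ChainGap⇒portrayal-gapless : ∀ B → IsRChain n lam B → ChainGap B → IsGaplessKey n lam (portrayal n lam B)
  ChainGap⇒portrayal-gapless B ch cg =
    Portrayal.portrayal-IsKey B ch ,
    ColumnsOf.ChainGap⇒GaplessPart (portrayal n lam B) B (Portrayal.InColsOfLen-portrayal B ch) (RChain-≤n B ch) cg

  portrayal-gapless⇒ChainGap : ∀ B → IsRChain n lam B → IsGaplessKey n lam (portrayal n lam B) → ChainGap B
  portrayal-gapless⇒ChainGap B ch gk =
    ColumnsOf.GaplessPart⇒ChainGap (portrayal n lam B) B (Portrayal.InColsOfLen-portrayal B ch) (RChain-≤n B ch) (proj₂ gk)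

  RCD⇒portrayal-gapless : ∀ B → IsRCD n lam B → IsGaplessKey n lam (portrayal n lam B)
  RCD⇒portrayal-gapless B (ch , rcd) = ChainGap⇒portrayal-gapless B ch (ChainGaps.RCD⇒ChainGap B ch rcd)

  portrayal-injective-RCD : ∀ B B' → IsRCD n lam B → IsRCD n lam B' →
                            TabEq n lam (portrayal n lam B) (portrayal n lam B') → ChainEq n lam B B'
  portrayal-injective-RCD B B' (ch , _) (ch' , _) = portrayal-injective B B' ch ch'

  gaplessKey-ChainGap : ∀ Y → IsGaplessKey n lam Y → ChainGap (chainOfKey Y)
  gaplessKey-ChainGap Y (key , gapless) =
    ColumnsOf.GaplessPart⇒ChainGap Y (chainOfKey Y) (KeyChain.InColsOfLen-chainOfKey Y key)
                                   (RChain-≤n (chainOfKey Y) (KeyChain.chainOfKey-RChain Y key)) gapless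

  gaplessKey⇒portrayal-RCD : ∀ Y → IsGaplessKey n lam Y → ∃[ B ] (IsRCD n lam B × TabEq n lam (portrayal n lam B) Y)
  gaplessKey⇒portrayal-RCD Y gk@(key , _) =
    chainOfKey Y , (ch , ChainGaps.ChainGap⇒RCD (chainOfKey Y) ch (gaplessKey-ChainGap Y gk)) , KeyChain.portrayal-chainOfKey Y key
    where
    ch = KeyChain.chainOfKey-RChain Y key

  avoiding⇒chainOf-RCD : ∀ π → Avoids312 n lam π → IsRCD n lam (chainOf n lam π)
  avoiding⇒chainOf-RCD π ((perm , _) , ¬312) =
    ch , ChainGaps.ChainGap⇒RCD (chainOf n lam π) ch (PermChain.¬312⇒ChainGap π perm ¬312)
    where
    ch = PermChain.chainOf-RChain π perm

  ¬312⇒keyOf-gapless : ∀ π → SnR n lam π → ¬ Contains312 n lam π → IsGaplessKey n lam (keyOf n lam π)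
  ¬312⇒keyOf-gapless π (perm , _) ¬312 =
    ChainGap⇒portrayal-gapless (chainOf n lam π) (PermChain.chainOf-RChain π perm) (PermChain.¬312⇒ChainGap π perm ¬312)

  keyOf-gapless⇒¬312 : ∀ π → SnR n lam π → IsGaplessKey n lam (keyOf n lam π) → ¬ Contains312 n lam π
  keyOf-gapless⇒¬312 π (perm , _) gk =
    PermChain.ChainGap⇒¬312 π perm (portrayal-gapless⇒ChainGap (chainOf n lam π) (PermChain.chainOf-RChain π perm) gk)

  keyOf-πOf : ∀ B (ch : IsRChain n lam B) → TabEq n lam (keyOf n lam (RChain.πOf B ch)) (portrayal n lam B)
  keyOf-πOf B ch j i (a , b , _ , _) =
    trans (Portrayal.portrayal-column (chainOf n lam πOf) (PermChain.chainOf-RChain πOf πOf-IsPerm) j a b i)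
          (trans (column-ext n _ _ (λ x _ _ → chainOf-πOf (carrel′ (ζ j)) (proj₁ (proj₂ (carrel′-ζ-spec j a b))) x) i)
                 (sym (Portrayal.portrayal-column B ch j a b i)))
    where open RChain B ch

  gaplessKey⇒keyOf-avoiding : ∀ Y → IsGaplessKey n lam Y → ∃[ π ] (Avoids312 n lam π × TabEq n lam (keyOf n lam π) Y)
  gaplessKey⇒keyOf-avoiding Y gk@(key , _) =
    RChain.πOf B ch , ChainGap⇒avoiding-πOf B ch (gaplessKey-ChainGap Y gk) ,
    λ j i box → trans (keyOf-πOf B ch j i box) (KeyChain.portrayal-chainOfKey Y key j i box)
    where
    B = chainOfKey Y
    ch = KeyChain.chainOfKey-RChain Y key

  M-of-gapless : ∀ γ → (ug : UG n lam γ) → IsM n lam γ (keyOf n lam (PermOfGapless.π γ ug))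
  M-of-gapless γ ug = IsM-cong _ γ _ Psi≡γ (AvoidingPerm.keyOf-IsM π avoiding)
    where open PermOfGapless γ ug

  M-exists : ∀ γ → UG n lam γ → ∃[ M ] IsM n lam γ M
  M-exists γ ug = keyOf n lam (PermOfGapless.π γ ug) , M-of-gapless γ ug

  IsM-unique : ∀ γ M M' → IsM n lam γ M → IsM n lam γ M' → TabEq n lam M M'
  IsM-unique γ M M' ((tM , fM) , maxM) ((tM' , fM') , maxM') j i box =
    ≤-antisym (maxM' M tM fM j i box) (maxM M' tM' fM' j i box)

  M-injective : ∀ γ γ' M M' → UI n lam γ → UI n lam γ' → IsM n lam γ M → IsM n lam γ' M' →
                TabEq n lam M M' → TupleEq n lam γ γ'
  M-injective γ γ' M M' ui ui' ((_ , fM) , _) ((_ , fM') , _) te i a b with lam i in el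
  ... | zero = trans (UI-fixed-beyond-parts γ ui i a b el) (sym (UI-fixed-beyond-parts γ' ui' i a b el))
  ... | suc _ = trans (sym (fM i a b l1)) (trans (te (lam i) i (l1 , lam-antitone 1 i ≤-refl a b , a , ≤lam⇒≤ζ (lam i) i a b ≤-refl)) (fM' i a b l1))
    where
    l1 : 1 ≤ lam i
    l1 = subst (1 ≤_) (sym el) (s≤s z≤n)

  M-is-keyOf-avoiding : ∀ γ M → UG n lam γ → IsM n lam γ M → ∃[ π ] (Avoids312 n lam π × TabEq n lam (keyOf n lam π) M)
  M-is-keyOf-avoiding γ M ug isM =
    PermOfGapless.π γ ug , PermOfGapless.avoiding γ ug , IsM-unique γ _ M (M-of-gapless γ ug) isM

theorem9p2 : (n : ℕ) (lam : ℕ → ℕ) → 1 ≤ n → IsPartition n lam →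
    ( ( (∀ B → IsRCD n lam B → IsGaplessKey n lam (portrayal n lam B))
      × (∀ B B' → IsRCD n lam B → IsRCD n lam B' →
           TabEq n lam (portrayal n lam B) (portrayal n lam B') → ChainEq n lam B B')
      × (∀ Y → IsGaplessKey n lam Y → ∃[ B ] (IsRCD n lam B × TabEq n lam (portrayal n lam B) Y)) )
    × ( (∀ γ → UG n lam γ → ∃[ M ] IsM n lam γ M)
      × (∀ γ γ' M M' → UG n lam γ → UG n lam γ' → IsM n lam γ M → IsM n lam γ' M' →
           TabEq n lam M M' → TupleEq n lam γ γ') ) )
    × ( (∀ π → Avoids312 n lam π → IsRCD n lam (chainOf n lam π))
      × (∀ π → Avoids312 n lam π → IsGaplessKey n lam (keyOf n lam π))
      × (∀ Y → IsGaplessKey n lam Y → ∃[ π ] (Avoids312 n lam π × TabEq n lam (keyOf n lam π) Y))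
      × (∀ π → SnR n lam π →
           ((¬ Contains312 n lam π → IsGaplessKey n lam (keyOf n lam π))
            × (IsGaplessKey n lam (keyOf n lam π) → ¬ Contains312 n lam π))) )
    × ( (∀ π → Avoids312 n lam π → IsM n lam (Psi n lam π) (keyOf n lam π))
      × (∀ π → Avoids312 n lam π → UG n lam (Psi n lam π))
      × (∀ γ M → UG n lam γ → IsM n lam γ M → ∃[ π ] (Avoids312 n lam π × TabEq n lam (keyOf n lam π) M)) )
theorem9p2 n lam n≥1 part =
  ( (RCD⇒portrayal-gapless , portrayal-injective-RCD , gaplessKey⇒portrayal-RCD)
  , (M-exists , λ γ γ' M M' ug ug' → M-injective γ γ' M M' (proj₁ ug) (proj₁ ug')) )
  , ( avoiding⇒chainOf-RCD
    , (λ π (snr , ¬312) → ¬312⇒keyOf-gapless π snr ¬312)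
    , gaplessKey⇒keyOf-avoiding
    , (λ π snr → ¬312⇒keyOf-gapless π snr , keyOf-gapless⇒¬312 π snr) )
  , ( AvoidingPerm.keyOf-IsM
    , AvoidingPerm.Psi-UG
    , M-is-keyOf-avoiding )
  where
  open Maximal n lam n≥1 part
  open Main n lam n≥1 part
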